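{- Let $f(x)=a_nx^n+\dots+a_0$ be a polynomial of degree $n$ with integer coefficients and let $q$ be an odd prime. Suppose $a_0\not\equiv 0\pmod q$, that the congruence $f(x)\equiv 0\pmod q$ has $\ell$ solutions in $\mathbb{Z}_q$, and that exactly $b$ of these solutions are quadratic residues modulo $q$. Then $$R\bigl(f(x),x^{\frac{q-1}{2}}-1\bigr)= a_n^{\frac{q-1}{2}}\prod_{i=1}^n\bigl(\alpha_i^{\frac{q-1}{2}}-1\bigr)\equiv 0\pmod{q^{b}}$$ and $$R\bigl(f(x),x^{\frac{q-1}{2}}+1\bigr)= a_n^{\frac{q-1}{2}}\prod_{i=1}^n\bigl(\alpha_i^{\frac{q-1}{2}}+1\bigr)\equiv 0\pmod{q^{\ell-b}},$$ where $\alpha_1,\dots,\alpha_n$ are the complex roots of $f(x)$, each repeated according to its multiplicity.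
   Context: For $f(x)=\sum_{i=0}^n a_i x^i$ and $g(x)=\sum_{j=0}^m b_j x^j$ of degrees $n$ and $m$, the resultant $R(f,g)$ is the determinant of the Sylvester matrix; equivalently $R(f,g)=a_n^m\prod_{i=1}^n g(\alpha_i)$, where $\alpha_i$ are the roots of $f$ with multiplicity. -}

module Defs where

open import Data.Nat as ℕ using (ℕ; zero; suc; _≤?_)
open import Data.Nat.Divisibility as ℕD using (_∣?_)
open import Data.Integer as ℤ using (ℤ; +_; _-_; _*_; _^_; ∣_∣)
open import Data.Fin as Fin using (Fin; toℕ; splitAt; punchIn; fromℕ<)
open import Data.Sum using (inj₁; inj₂)
open import Data.List using (List; upTo; filter; length)
open import Data.List.Relation.Unary.Any using (any?)
open import Data.Product using (_×_)
open import Relation.Nullary using (Dec; ¬_; yes; no)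
open import Relation.Nullary.Decidable using (_×-dec_; ¬?)

sumFin : ∀ k → (Fin k → ℤ) → ℤ
sumFin zero    f = + 0
sumFin (suc k) f = f Fin.zero ℤ.+ sumFin k (λ i → f (Fin.suc i))

det : ∀ k → (Fin k → Fin k → ℤ) → ℤ
det zero    M = + 1
det (suc k) M =
  sumFin (suc k) (λ j → (ℤ.- (+ 1)) ^ toℕ j * M Fin.zero j
                        * det k (λ r c → M (Fin.suc r) (punchIn j c)))

-- A polynomial of degree ≤ d is given by its coefficient vector
-- c : Fin (suc d) → ℤ, where c i is the coefficient of x^i.

coeff : ∀ d → (Fin (suc d) → ℤ) → ℕ → ℤ
coeff d c i with i ℕ.<? suc d
... | yes p = c (fromℕ< p)
... | no  _ = + 0

-- Sylvester-matrix entry: the row is the coefficient vector of a degree-d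
-- polynomial (highest coefficient first), shifted right by `shift` places.
sylEntry : ∀ d → (Fin (suc d) → ℤ) → ℕ → ℕ → ℤ
sylEntry d c shift j with shift ≤? j
... | yes _ with j ℕ.∸ shift ≤? d
...   | yes _ = coeff d c (d ℕ.∸ (j ℕ.∸ shift))
...   | no  _ = + 0
sylEntry d c shift j | no _ = + 0

sylvester : ∀ n m → (Fin (suc n) → ℤ) → (Fin (suc m) → ℤ) → Fin (m ℕ.+ n) → Fin (m ℕ.+ n) → ℤ
sylvester n m f g r j with splitAt m r
... | inj₁ i = sylEntry n f (toℕ i) (toℕ j)
... | inj₂ i = sylEntry m g (toℕ i) (toℕ j)

resultant : ∀ n m → (Fin (suc n) → ℤ) → (Fin (suc m) → ℤ) → ℤ
resultant n m f g = det (m ℕ.+ n) (sylvester n m f g)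

eval : ∀ d → (Fin (suc d) → ℤ) → ℤ → ℤ
eval d c x = sumFin (suc d) (λ i → c i * x ^ toℕ i)

xPowPlus : ∀ m → ℤ → Fin (suc m) → ℤ
xPowPlus m s i = top ℤ.+ bot
  where
  top : ℤ
  top with toℕ i ℕ.≟ m
  ... | yes _ = + 1
  ... | no  _ = + 0
  bot : ℤ
  bot with toℕ i ℕ.≟ 0
  ... | yes _ = s
  ... | no  _ = + 0

divides? : ∀ q (z : ℤ) → Dec (q ℕD.∣ ∣ z ∣)
divides? q z = q ∣? ∣ z ∣

IsQR? : ∀ q (x : ℕ) → Dec (¬ (q ℕD.∣ x) × Data.List.Relation.Unary.Any.Any (λ y → q ℕD.∣ ∣ (+ y) * (+ y) - (+ x) ∣) (upTo q))
IsQR? q x = ¬? (q ∣? x) ×-dec any? (λ y → q ∣? ∣ (+ y) * (+ y) - (+ x) ∣) (upTo q)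

numRoots : ∀ q d → (Fin (suc d) → ℤ) → ℕ
numRoots q d f = length (filter (λ x → divides? q (eval d f (+ x))) (upTo q))

numQRRoots : ∀ q d → (Fin (suc d) → ℤ) → ℕ
numQRRoots q d f =
  length (filter (λ x → divides? q (eval d f (+ x)) ×-dec IsQR? q x) (upTo q))

{-# OPTIONS --safe #-}
-- Write q = 2m + 1. Since q ∤ a₀, no root of f is 0 mod q, so by Fermat every root x has
-- x^(2m) ≡ 1. Euler's criterion sorts the roots: x^m ≡ 1 for a quadratic residue, and for a
-- nonresidue x^m ≡ −1, because x^m − 1 of degree m already has the m distinct roots 1², …, m².
-- Thus the b residue roots are common roots of f and x^m − 1 mod q, the ℓ − b others common
-- roots of f and x^m + 1.
--
-- If f and a monic g have k distinct common roots mod q, the factor theorem mod q gives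
-- f ≡ L·f′ and g ≡ L·g′ with deg L = k, so g′·f − f′·g ≡ 0 (mod q). For d = k − 1, …, 0 the
-- coefficients of x^d·g′ and −x^d·f′ are weights for the rows of the Sylvester matrix which
-- give one row weight 1 and produce a row divisible by q; replacing that row by the weighted
-- sum keeps the determinant and pulls out a factor q. Hence q^k divides the resultant.
module Submission where

module Lemmas where

  open import Defs
  open import Data.Empty using (⊥-elim)
  open import Data.Fin as Fin using (Fin; zero; suc; toℕ; punchIn; fromℕ; fromℕ<; inject₁; _↑ˡ_; _↑ʳ_; splitAt)
  import Data.Fin.Properties as Fin
  open import Data.Integer as ℤ using (ℤ; +_; _+_; _*_; -_; _-_; _^_; -1ℤ)
  open import Data.Integer.Divisibility.Signed
    using (_∣_; divides; ∣ᵤ⇒∣; ∣⇒∣ᵤ; ∣m∣n⇒∣m+n; ∣m∣n⇒∣m-n; ∣n⇒∣m*n; ∣m⇒∣m*n; ∣m⇒∣-m; *-monoʳ-∣)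
  open import Data.Integer.Properties
  open import Data.Integer.Tactic.RingSolver using (solve-∀)
  open import Algebra.Properties.AbelianGroup +-0-abelianGroup using (∙-cancelˡ)
  import Algebra.Properties.CommutativeSemiring.Binomial +-*-commutativeSemiring as Binomial
  open import Algebra.Properties.Semiring.Exp +-*-semiring using () renaming (_^_ to _^ᴿ_)
  open import Algebra.Properties.Semiring.Mult +-*-semiring using () renaming (_×_ to _×ᴿ_)
  open import Algebra.Properties.Semiring.Sum +-*-semiring
    using (sum; sum-cong-≗; ∑-distrib-+; *-distribˡ-sum; ∑-comm; sum-remove; sum-replicate-zero; sum-init-last)
  open import Data.List using (List; []; _∷_; length; map; applyUpTo; upTo; filter)
  open import Data.List.Membership.Propositional using (lose)
  open import Data.List.Membership.Propositional.Properties using (∈-upTo⁺)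
  open import Data.List.Properties using (length-map; length-applyUpTo)
  open import Data.List.Relation.Unary.All using (All; []; _∷_)
  import Data.List.Relation.Unary.All as All
  import Data.List.Relation.Unary.All.Properties as All
  open import Data.List.Relation.Unary.AllPairs using (AllPairs; []; _∷_)
  import Data.List.Relation.Unary.AllPairs as AllPairs
  import Data.List.Relation.Unary.AllPairs.Properties as AllPairs
  open import Data.List.Relation.Unary.Any using (Any; satisfied)
  open import Data.Nat as ℕ using (ℕ; zero; suc; z≤n; s≤s; _∸_)
  import Data.Nat.Combinatorics as ℕ
  import Data.Nat.Divisibility as ℕ
  open import Data.Nat.Primality using (Prime; euclidsLemma)
  import Data.Nat.Properties as ℕ
  open import Data.Nat.Tactic.RingSolver renaming (solve-∀ to ℕ-solve-∀)
  open import Data.Product using (_×_; _,_; proj₁; proj₂)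
  open import Data.Sum using (_⊎_; inj₁; inj₂; [_,_]′)
  open import Data.Vec.Functional using (updateAt)
  open import Data.Vec.Functional.Properties using (updateAt-updates; updateAt-minimal; updateAt-id-local)
  open import Function using (const; id; _∘_)
  open import Relation.Binary.PropositionalEquality
  open import Relation.Nullary using (¬_; yes; no; Dec)
  open import Relation.Nullary.Decidable using (_×-dec_; ¬?)

  -- Finite sums

  sumFin≡sum : ∀ k (f : Fin k → ℤ) → sumFin k f ≡ sum f
  sumFin≡sum zero    f = refl
  sumFin≡sum (suc k) f = cong (_+_ (f zero)) (sumFin≡sum k (λ i → f (suc i)))

  sum-zero : ∀ {k} (f : Fin k → ℤ) → (∀ i → f i ≡ + 0) → sum f ≡ + 0
  sum-zero {k} f f≡0 = trans (sum-cong-≗ f≡0) (sum-replicate-zero k)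

  sum-neg : ∀ {k} (f : Fin k → ℤ) → sum (λ i → - f i) ≡ - sum f
  sum-neg f = begin
    sum (λ i → - f i)      ≡⟨ sum-cong-≗ (λ i → sym (-1*i≡-i (f i))) ⟩
    sum (λ i → -1ℤ * f i)  ≡⟨ *-distribˡ-sum -1ℤ f ⟨
    -1ℤ * sum f            ≡⟨ -1*i≡-i (sum f) ⟩
    - sum f                ∎
    where open ≡-Reasoning

  sum-linear : ∀ {k} x y (f g h : Fin k → ℤ) → (∀ j → f j ≡ x * g j + y * h j) →
    sum f ≡ x * sum g + y * sum h
  sum-linear x y f g h f≡ = begin
    sum f                                     ≡⟨ sum-cong-≗ f≡ ⟩
    sum (λ j → x * g j + y * h j)             ≡⟨ ∑-distrib-+ (λ j → x * g j) (λ j → y * h j) ⟩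
    sum (λ j → x * g j) + sum (λ j → y * h j) ≡⟨ cong₂ _+_ (*-distribˡ-sum x g) (*-distribˡ-sum y h) ⟨
    x * sum g + y * sum h                     ∎
    where open ≡-Reasoning

  sum-delta : ∀ {k} (i : Fin (suc k)) (f : Fin (suc k) → ℤ) →
    (∀ j → f (punchIn i j) ≡ + 0) → sum f ≡ f i
  sum-delta i f f≡0 = trans (sum-remove {i = i} f)
    (trans (cong (_+_ (f i)) (sum-zero _ f≡0)) (+-identityʳ (f i)))

  sum-offDiagonal-transpose : ∀ {k} (F : Fin (suc k) → Fin (suc k) → ℤ) →
    sum (λ a → sum (λ b → F a (punchIn a b))) ≡ sum (λ a → sum (λ b → F (punchIn a b) a))
  sum-offDiagonal-transpose F = ∙-cancelˡ (sum (λ a → F a a)) _ _ (begin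
      sum (λ a → F a a) + sum (λ a → sum (λ b → F a (punchIn a b)))
    ≡⟨ ∑-distrib-+ (λ a → F a a) (λ a → sum (λ b → F a (punchIn a b))) ⟨
      sum (λ a → F a a + sum (λ b → F a (punchIn a b)))
    ≡⟨ sum-cong-≗ (λ a → sum-remove {i = a} (F a)) ⟨
      sum (λ a → sum (λ c → F a c))
    ≡⟨ ∑-comm F ⟩
      sum (λ c → sum (λ a → F a c))
    ≡⟨ sum-cong-≗ (λ a → sum-remove {i = a} (λ c → F c a)) ⟩
      sum (λ a → F a a + sum (λ b → F (punchIn a b) a))
    ≡⟨ ∑-distrib-+ (λ a → F a a) (λ a → sum (λ b → F (punchIn a b) a)) ⟩
      sum (λ a → F a a) + sum (λ a → sum (λ b → F (punchIn a b) a))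
    ∎)
    where open ≡-Reasoning

  -- Determinants

  Matrix : ℕ → Set
  Matrix k = Fin k → Fin k → ℤ

  sign : ∀ {k} → Fin k → ℤ
  sign j = (- + 1) ^ toℕ j

  minor : ∀ {k} → Matrix (suc k) → Fin (suc k) → Matrix k
  minor M j r c = M (suc r) (punchIn j c)

  det-expand : ∀ k (M : Matrix (suc k)) →
    det (suc k) M ≡ sum (λ j → sign j * M zero j * det k (minor M j))
  det-expand k M = sumFin≡sum (suc k) (λ j → sign j * M zero j * det k (minor M j))

  det-cong : ∀ k {M N : Matrix k} → (∀ r c → M r c ≡ N r c) → det k M ≡ det k N
  det-cong zero    M≡N = refl
  det-cong (suc k) {M} {N} M≡N = begin
    det (suc k) M                                      ≡⟨ det-expand k M ⟩
    sum (λ j → sign j * M zero j * det k (minor M j))  ≡⟨ sum-cong-≗ term≡ ⟩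
    sum (λ j → sign j * N zero j * det k (minor N j))  ≡⟨ det-expand k N ⟨
    det (suc k) N                                      ∎
    where
    open ≡-Reasoning
    term≡ : ∀ j → sign j * M zero j * det k (minor M j) ≡ sign j * N zero j * det k (minor N j)
    term≡ j = cong₂ (λ x y → sign j * x * y) (M≡N zero j) (det-cong k (λ r c → M≡N (suc r) (punchIn j c)))

  SameOffRow : ∀ {k} → Fin k → Matrix k → Matrix k → Set
  SameOffRow i A B = ∀ r → r ≢ i → ∀ c → A r c ≡ B r c

  det-linear-row : ∀ k (A B C : Matrix k) (i : Fin k) (x y : ℤ) →
    SameOffRow i A B → SameOffRow i A C → (∀ c → A i c ≡ x * B i c + y * C i c) →
    det k A ≡ x * det k B + y * det k C
  det-linear-row (suc k) A B C i x y A≡B A≡C Aᵢ≡ = begin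
    det (suc k) A                           ≡⟨ det-expand k A ⟩
    sum (term A)                            ≡⟨ sum-linear x y (term A) (term B) (term C) (term-linear i A≡B A≡C Aᵢ≡) ⟩
    x * sum (term B) + y * sum (term C)     ≡⟨ cong₂ (λ u v → x * u + y * v) (det-expand k B) (det-expand k C) ⟨
    x * det (suc k) B + y * det (suc k) C   ∎
    where
    open ≡-Reasoning
    term : Matrix (suc k) → Fin (suc k) → ℤ
    term M j = sign j * M zero j * det k (minor M j)
    term-linear : ∀ i → SameOffRow i A B → SameOffRow i A C →
      (∀ c → A i c ≡ x * B i c + y * C i c) → ∀ j → term A j ≡ x * term B j + y * term C j
    term-linear zero A≡B A≡C A₀≡ j
      rewrite A₀≡ j
            | det-cong k {minor A j} {minor B j} (λ r c → A≡B (suc r) (λ ()) _)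
            | det-cong k {minor B j} {minor C j} (λ r c → trans (sym (A≡B (suc r) (λ ()) _)) (A≡C (suc r) (λ ()) _))
      = distrib x y (sign j) (B zero j) (C zero j) (det k (minor C j))
      where
      distrib : ∀ x y s b c d → s * (x * b + y * c) * d ≡ x * (s * b * d) + y * (s * c * d)
      distrib = solve-∀
    term-linear (suc i) A≡B A≡C Aᵢ≡ j = begin
      sign j * A zero j * det k (minor A j)
        ≡⟨ cong (sign j * A zero j *_) (det-linear-row k (minor A j) (minor B j) (minor C j) i x y
             (λ r r≢i c → A≡B (suc r) (r≢i ∘ Fin.suc-injective) _)
             (λ r r≢i c → A≡C (suc r) (r≢i ∘ Fin.suc-injective) _)
             (λ c → Aᵢ≡ _)) ⟩
      sign j * A zero j * (x * det k (minor B j) + y * det k (minor C j))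
        ≡⟨ distrib x y (sign j) (A zero j) (det k (minor B j)) (det k (minor C j)) ⟩
      x * (sign j * A zero j * det k (minor B j)) + y * (sign j * A zero j * det k (minor C j))
        ≡⟨ cong₂ (λ u v → x * (sign j * u * det k (minor B j)) + y * (sign j * v * det k (minor C j)))
             (A≡B zero (λ ()) j) (A≡C zero (λ ()) j) ⟩
      x * term B j + y * term C j
        ∎
      where
      distrib : ∀ x y s a u v → s * a * (x * u + y * v) ≡ x * (s * a * u) + y * (s * a * v)
      distrib = solve-∀

  -- A total punchOut: the position of c after deleting a (junk when a ≡ c).
  punchOut′ : ∀ {k} → Fin (suc (suc k)) → Fin (suc (suc k)) → Fin (suc k)
  punchOut′ zero    zero    = zero
  punchOut′ zero    (suc c) = c
  punchOut′ (suc a) zero    = zero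
  punchOut′ {zero}  (suc a) (suc c) = zero
  punchOut′ {suc k} (suc a) (suc c) = suc (punchOut′ a c)

  punchOut′-punchIn : ∀ {k} (a : Fin (suc (suc k))) (b : Fin (suc k)) → punchOut′ a (punchIn a b) ≡ b
  punchOut′-punchIn zero    b       = refl
  punchOut′-punchIn (suc a) zero    = refl
  punchOut′-punchIn {suc k} (suc a) (suc b) = cong suc (punchOut′-punchIn a b)

  sign-punchOut′-antisym : ∀ {k} (a c : Fin (suc (suc k))) → a ≢ c →
    sign a * sign (punchOut′ a c) ≡ - (sign c * sign (punchOut′ c a))
  sign-punchOut′-antisym zero    zero    a≢c = ⊥-elim (a≢c refl)
  sign-punchOut′-antisym zero    (suc c) a≢c = flip (sign c)
    where
    flip : ∀ x → + 1 * x ≡ - ((- + 1 * x) * + 1)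
    flip = solve-∀
  sign-punchOut′-antisym (suc a) zero    a≢c = flip (sign a)
    where
    flip : ∀ x → (- + 1 * x) * + 1 ≡ - (+ 1 * x)
    flip = solve-∀
  sign-punchOut′-antisym {zero}  (suc zero) (suc zero) a≢c = ⊥-elim (a≢c refl)
  sign-punchOut′-antisym {suc k} (suc a) (suc c) a≢c = begin
    (- + 1 * sign a) * (- + 1 * sign (punchOut′ a c)) ≡⟨ square-flip (sign a) (sign (punchOut′ a c)) ⟩
    sign a * sign (punchOut′ a c)                     ≡⟨ sign-punchOut′-antisym a c (a≢c ∘ cong suc) ⟩
    - (sign c * sign (punchOut′ c a))                 ≡⟨ cong -_ (square-flip (sign c) (sign (punchOut′ c a))) ⟨
    - ((- + 1 * sign c) * (- + 1 * sign (punchOut′ c a))) ∎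
    where
    open ≡-Reasoning
    square-flip : ∀ x y → (- + 1 * x) * (- + 1 * y) ≡ x * y
    square-flip = solve-∀

  punchIn-punchOut′-comm : ∀ {k} (a c : Fin (suc (suc k))) → a ≢ c → ∀ x →
    punchIn a (punchIn (punchOut′ a c) x) ≡ punchIn c (punchIn (punchOut′ c a) x)
  punchIn-punchOut′-comm zero    zero    a≢c x = ⊥-elim (a≢c refl)
  punchIn-punchOut′-comm zero    (suc c) a≢c x = refl
  punchIn-punchOut′-comm (suc a) zero    a≢c x = refl
  punchIn-punchOut′-comm {zero}  (suc zero) (suc zero) a≢c x = ⊥-elim (a≢c refl)
  punchIn-punchOut′-comm {suc k} (suc a) (suc c) a≢c zero    = refl
  punchIn-punchOut′-comm {suc k} (suc a) (suc c) a≢c (suc x) =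
    cong suc (punchIn-punchOut′-comm a c (a≢c ∘ cong suc) x)

  module _ {k : ℕ} where

    -- Delete the first two rows and the columns a (of row 0) and c (of row 1).
    minor₂ : Matrix (suc (suc k)) → Fin (suc (suc k)) → Fin (suc (suc k)) → ℤ
    minor₂ M a c = det k (λ r x → M (suc (suc r)) (punchIn a (punchIn (punchOut′ a c) x)))

    term₂ : Matrix (suc (suc k)) → Fin (suc (suc k)) → Fin (suc (suc k)) → ℤ
    term₂ M a c = sign a * sign (punchOut′ a c) * (M zero a * (M (suc zero) c * minor₂ M a c))

    minor₂-sym : ∀ M a c → a ≢ c → minor₂ M a c ≡ minor₂ M c a
    minor₂-sym M a c a≢c = det-cong k (λ r x → cong (M (suc (suc r))) (punchIn-punchOut′-comm a c a≢c x))

    det-expand₂ : ∀ M → det (suc (suc k)) M ≡ sum (λ a → sum (λ b → term₂ M a (punchIn a b)))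
    det-expand₂ M = trans (det-expand (suc k) M) (sum-cong-≗ λ a →
      trans (cong (sign a * M zero a *_) (det-expand k (minor M a)))
        (trans (*-distribˡ-sum (sign a * M zero a) (λ b → sign b * minor M a zero b * det k (minor (minor M a) b)))
          (sum-cong-≗ λ b → trans (reassoc (sign a) (M zero a) (sign b) (M (suc zero) (punchIn a b)) (det k (minor (minor M a) b)))
            (cong (λ b′ → sign a * sign b′ * (M zero a * (M (suc zero) (punchIn a b) *
                    det k (λ r x → M (suc (suc r)) (punchIn a (punchIn b′ x))))))
                  (sym (punchOut′-punchIn a b))))))
      where
      reassoc : ∀ sa m₀ sb m₁ d → sa * m₀ * (sb * m₁ * d) ≡ sa * sb * (m₀ * (m₁ * d))
      reassoc = solve-∀

  swapRows01 : ∀ {k} → Matrix (suc (suc k)) → Matrix (suc (suc k))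
  swapRows01 M zero             = M (suc zero)
  swapRows01 M (suc zero)       = M zero
  swapRows01 M (suc (suc r))    = M (suc (suc r))

  -- Expanding along the first two rows, swapping them transposes the off-diagonal double sum.
  det-swapRows01 : ∀ k (M : Matrix (suc (suc k))) → det (suc (suc k)) (swapRows01 M) ≡ - det (suc (suc k)) M
  det-swapRows01 k M = begin
      det (suc (suc k)) (swapRows01 M)
    ≡⟨ det-expand₂ (swapRows01 M) ⟩
      sum (λ a → sum (λ b → term₂ (swapRows01 M) a (punchIn a b)))
    ≡⟨ sum-cong-≗ (λ a → sum-cong-≗ (λ b → term₂-swap a (punchIn a b) (Fin.punchInᵢ≢i a b ∘ sym))) ⟩
      sum (λ a → sum (λ b → - term₂ M (punchIn a b) a))
    ≡⟨ sum-cong-≗ (λ a → sum-neg (λ b → term₂ M (punchIn a b) a)) ⟩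
      sum (λ a → - sum (λ b → term₂ M (punchIn a b) a))
    ≡⟨ sum-neg (λ a → sum (λ b → term₂ M (punchIn a b) a)) ⟩
      - sum (λ a → sum (λ b → term₂ M (punchIn a b) a))
    ≡⟨ cong -_ (sum-offDiagonal-transpose (term₂ M)) ⟨
      - sum (λ a → sum (λ b → term₂ M a (punchIn a b)))
    ≡⟨ cong -_ (det-expand₂ M) ⟨
      - det (suc (suc k)) M
    ∎
    where
    open ≡-Reasoning
    rearrange : ∀ s s′ u v e → s ≡ - s′ → s * (u * (v * e)) ≡ - (s′ * (v * (u * e)))
    rearrange s s′ u v e refl = lemma s′ u v e
      where
      lemma : ∀ s′ u v e → - s′ * (u * (v * e)) ≡ - (s′ * (v * (u * e)))
      lemma = solve-∀
    term₂-swap : ∀ a c → a ≢ c → term₂ (swapRows01 M) a c ≡ - term₂ M c a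
    term₂-swap a c a≢c = trans
      (cong (λ e → sign a * sign (punchOut′ a c) * (M (suc zero) a * (M zero c * e))) (minor₂-sym M a c a≢c))
      (rearrange _ _ (M (suc zero) a) (M zero c) (minor₂ M c a) (sign-punchOut′-antisym a c a≢c))

  x≡-x⇒x≡0 : ∀ x → x ≡ - x → x ≡ + 0
  x≡-x⇒x≡0 (+ zero)     _ = refl
  x≡-x⇒x≡0 (+ (suc n))  ()
  x≡-x⇒x≡0 (ℤ.-[1+ n ]) ()

  mutual
    det-repeatedRow : ∀ k (M : Matrix k) i j → i ≢ j → (∀ c → M i c ≡ M j c) → det k M ≡ + 0
    det-repeatedRow (suc k) M zero    zero    i≢j Mᵢ≡Mⱼ = ⊥-elim (i≢j refl)
    det-repeatedRow (suc k) M zero    (suc j) i≢j Mᵢ≡Mⱼ = det-repeatedRow₀ k M j Mᵢ≡Mⱼ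
    det-repeatedRow (suc k) M (suc i) zero    i≢j Mᵢ≡Mⱼ = det-repeatedRow₀ k M i (sym ∘ Mᵢ≡Mⱼ)
    det-repeatedRow (suc k) M (suc i) (suc j) i≢j Mᵢ≡Mⱼ = det-repeatedRowₛ k M i j (i≢j ∘ cong suc) Mᵢ≡Mⱼ

    det-repeatedRowₛ : ∀ k (M : Matrix (suc k)) i j → i ≢ j →
      (∀ c → M (suc i) c ≡ M (suc j) c) → det (suc k) M ≡ + 0
    det-repeatedRowₛ k M i j i≢j Mᵢ≡Mⱼ = trans (det-expand k M) (sum-zero _ λ a →
      trans (cong (sign a * M zero a *_) (det-repeatedRow k (minor M a) i j i≢j (λ c → Mᵢ≡Mⱼ _)))
            (*-zeroʳ (sign a * M zero a)))

    -- Row 0 repeated in row j: swapping rows 0 and 1 moves the repetition below row 0.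
    det-repeatedRow₀ : ∀ k (M : Matrix (suc k)) j → (∀ c → M zero c ≡ M (suc j) c) → det (suc k) M ≡ + 0
    det-repeatedRow₀ (suc k) M zero M₀≡M₁ = x≡-x⇒x≡0 (det (suc (suc k)) M)
      (trans (sym (det-cong (suc (suc k)) swap≡)) (det-swapRows01 k M))
      where
      swap≡ : ∀ r c → swapRows01 M r c ≡ M r c
      swap≡ zero          c = sym (M₀≡M₁ c)
      swap≡ (suc zero)    c = M₀≡M₁ c
      swap≡ (suc (suc r)) c = refl
    det-repeatedRow₀ (suc k) M (suc j) M₀≡Mⱼ = begin
      det (suc (suc k)) M                  ≡⟨ neg-involutive (det (suc (suc k)) M) ⟨
      - - det (suc (suc k)) M              ≡⟨ cong -_ (det-swapRows01 k M) ⟨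
      - det (suc (suc k)) (swapRows01 M)   ≡⟨ cong -_ (det-repeatedRowₛ (suc k) (swapRows01 M) zero (suc j) (λ ()) M₀≡Mⱼ) ⟩
      - + 0                                ∎
      where open ≡-Reasoning

  det-scaleRow : ∀ k (A B : Matrix k) (i : Fin k) (x : ℤ) →
    SameOffRow i A B → (∀ c → A i c ≡ x * B i c) → det k A ≡ x * det k B
  det-scaleRow k A B i x A≈B Aᵢ≡ = begin
    det k A                     ≡⟨ det-linear-row k A B B i x (+ 0) A≈B A≈B (λ c → trans (Aᵢ≡ c) (pad x (B i c))) ⟩
    x * det k B + + 0 * det k B ≡⟨ pad x (det k B) ⟨
    x * det k B                 ∎
    where
    open ≡-Reasoning
    pad : ∀ x b → x * b ≡ x * b + + 0 * b
    pad = solve-∀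

  replaceRow : ∀ {k} → Matrix k → Fin k → (Fin k → ℤ) → Matrix k
  replaceRow M i w = updateAt M i (const w)

  replaceRow-updates : ∀ {k} (M : Matrix k) i w c → replaceRow M i w i c ≡ w c
  replaceRow-updates M i w c = cong-app (updateAt-updates i M) c

  replaceRow-minimal : ∀ {k} (M : Matrix k) i w → SameOffRow i (replaceRow M i w) M
  replaceRow-minimal M i w r r≢i c = cong-app (updateAt-minimal r i M r≢i) c

  det-rowSum : ∀ N (M A : Matrix N) (i : Fin N) K (λs : Fin K → ℤ) (v : Fin K → Fin N → ℤ) →
    SameOffRow i A M → (∀ c → A i c ≡ sum (λ t → λs t * v t c)) →
    det N A ≡ sum (λ t → λs t * det N (replaceRow M i (v t)))
  det-rowSum N M A i zero λs v A≈M Aᵢ≡ =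
    trans (det-scaleRow N A M i (+ 0) A≈M (λ c → trans (Aᵢ≡ c) (sym (*-zeroˡ (M i c))))) (*-zeroˡ (det N M))
  det-rowSum N M A i (suc K) λs v A≈M Aᵢ≡ = begin
    det N A                                   ≡⟨ det-linear-row N A (replaceRow M i (v zero)) C i (λs zero) (+ 1)
                                                   (offRow (v zero)) (offRow rest) row-split ⟩
    λs zero * det N (replaceRow M i (v zero)) + + 1 * det N C
                                              ≡⟨ cong (_+_ (λs zero * det N (replaceRow M i (v zero))))
                                                   (trans (*-identityˡ (det N C))
                                                     (det-rowSum N M C i K (λs ∘ suc) (v ∘ suc)
                                                       (replaceRow-minimal M i rest) (replaceRow-updates M i rest))) ⟩
    sum (λ t → λs t * det N (replaceRow M i (v t))) ∎
    where
    open ≡-Reasoning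
    rest : Fin N → ℤ
    rest c = sum (λ t → λs (suc t) * v (suc t) c)
    C : Matrix N
    C = replaceRow M i rest
    offRow : ∀ w → SameOffRow i A (replaceRow M i w)
    offRow w r r≢i c = trans (A≈M r r≢i c) (sym (replaceRow-minimal M i w r r≢i c))
    row-split : ∀ c → A i c ≡ λs zero * replaceRow M i (v zero) i c + + 1 * C i c
    row-split c = trans (Aᵢ≡ c) (cong₂ (λ u w → λs zero * u + w)
      (sym (replaceRow-updates M i (v zero) c))
      (trans (sym (replaceRow-updates M i rest c)) (sym (*-identityˡ (C i c)))))

  -- Only the i-th summand survives: all others have a repeated row.
  det-rowCombination : ∀ N (M A : Matrix N) (i : Fin N) (λs : Fin N → ℤ) →
    SameOffRow i A M → (∀ c → A i c ≡ sum (λ r → λs r * M r c)) → det N A ≡ λs i * det N M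
  det-rowCombination (suc N) M A i λs A≈M Aᵢ≡ = begin
    det (suc N) A                                        ≡⟨ det-rowSum (suc N) M A i (suc N) λs M A≈M Aᵢ≡ ⟩
    sum (λ r → λs r * det (suc N) (replaceRow M i (M r))) ≡⟨ sum-delta i (λ r → λs r * det (suc N) (replaceRow M i (M r))) others-vanish ⟩
    λs i * det (suc N) (replaceRow M i (M i))            ≡⟨ cong (λs i *_) (det-cong (suc N) replace-self) ⟩
    λs i * det (suc N) M                                 ∎
    where
    open ≡-Reasoning
    others-vanish : ∀ b → λs (punchIn i b) * det (suc N) (replaceRow M i (M (punchIn i b))) ≡ + 0
    others-vanish b = trans (cong (λs (punchIn i b) *_)
        (det-repeatedRow (suc N) (replaceRow M i Mᵦ) i (punchIn i b) (Fin.punchInᵢ≢i i b ∘ sym)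
          (λ c → trans (replaceRow-updates M i Mᵦ c)
                       (sym (replaceRow-minimal M i Mᵦ (punchIn i b) (Fin.punchInᵢ≢i i b) c)))))
      (*-zeroʳ (λs (punchIn i b)))
      where
      Mᵦ : Fin (suc N) → ℤ
      Mᵦ = M (punchIn i b)
    replace-self : ∀ r c → replaceRow M i (M i) r c ≡ M r c
    replace-self r c = cong-app (updateAt-id-local i M refl r) c

  -- Polynomials as coefficient sequences

  Poly : Set
  Poly = ℕ → ℤ

  tailₚ : Poly → Poly
  tailₚ p i = p (suc i)

  infixl 7 _*ₚ_
  _*ₚ_ : Poly → Poly → Poly
  (p *ₚ s) zero    = p 0 * s 0
  (p *ₚ s) (suc n) = p 0 * s (suc n) + (tailₚ p *ₚ s) n

  mulX : Poly → Poly
  mulX p zero    = + 0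
  mulX p (suc n) = p n

  mulXPow : ℕ → Poly → Poly
  mulXPow zero    p = p
  mulXPow (suc e) p = mulX (mulXPow e p)

  mulLinear : ℤ → Poly → Poly
  mulLinear r s n = mulX s n - r * s n

  mulLinears : List ℤ → Poly → Poly
  mulLinears []       s = s
  mulLinears (r ∷ rs) s = mulLinear r (mulLinears rs s)

  constₚ : ℤ → Poly
  constₚ c zero    = c
  constₚ c (suc _) = + 0

  Deg≤ : ℕ → Poly → Set
  Deg≤ D p = ∀ i → D ℕ.< i → p i ≡ + 0

  *ₚ-cong : ∀ {p p′ s s′} → p ≗ p′ → s ≗ s′ → p *ₚ s ≗ p′ *ₚ s′
  *ₚ-cong p≗ s≗ zero    = cong₂ _*_ (p≗ 0) (s≗ 0)
  *ₚ-cong p≗ s≗ (suc n) = cong₂ _+_ (cong₂ _*_ (p≗ 0) (s≗ (suc n))) (*ₚ-cong (p≗ ∘ suc) s≗ n)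

  mulX-cong : ∀ {p p′} → p ≗ p′ → mulX p ≗ mulX p′
  mulX-cong p≗ zero    = refl
  mulX-cong p≗ (suc n) = p≗ n

  mulXPow-cong : ∀ e {p p′} → p ≗ p′ → mulXPow e p ≗ mulXPow e p′
  mulXPow-cong zero    p≗ = p≗
  mulXPow-cong (suc e) p≗ = mulX-cong (mulXPow-cong e p≗)

  mulLinear-cong : ∀ r {p p′} → p ≗ p′ → mulLinear r p ≗ mulLinear r p′
  mulLinear-cong r p≗ n = cong₂ (λ a b → a - r * b) (mulX-cong p≗ n) (p≗ n)

  mulLinears-cong : ∀ rs {p p′} → p ≗ p′ → mulLinears rs p ≗ mulLinears rs p′
  mulLinears-cong []       p≗ = p≗
  mulLinears-cong (r ∷ rs) p≗ = mulLinear-cong r (mulLinears-cong rs p≗)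

  *ₚ-comm : ∀ p s → p *ₚ s ≗ s *ₚ p
  *ₚ-comm p s zero          = *-comm (p 0) (s 0)
  *ₚ-comm p s (suc zero)    = swap (p 0) (s 1) (p 1) (s 0)
    where
    swap : ∀ a b c d → a * b + c * d ≡ d * c + b * a
    swap = solve-∀
  *ₚ-comm p s (suc (suc n)) = begin
    p 0 * s (suc (suc n)) + (tailₚ p *ₚ s) (suc n)
      ≡⟨ cong (_+_ (p 0 * s (suc (suc n)))) (*ₚ-comm (tailₚ p) s (suc n)) ⟩
    p 0 * s (suc (suc n)) + (s 0 * p (suc (suc n)) + (tailₚ s *ₚ tailₚ p) n)
      ≡⟨ cong (λ z → p 0 * s (suc (suc n)) + (s 0 * p (suc (suc n)) + z)) (*ₚ-comm (tailₚ s) (tailₚ p) n) ⟩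
    p 0 * s (suc (suc n)) + (s 0 * p (suc (suc n)) + (tailₚ p *ₚ tailₚ s) n)
      ≡⟨ swap (p 0) (s (suc (suc n))) (s 0) (p (suc (suc n))) ((tailₚ p *ₚ tailₚ s) n) ⟩
    s 0 * p (suc (suc n)) + (p 0 * s (suc (suc n)) + (tailₚ p *ₚ tailₚ s) n)
      ≡⟨ cong (_+_ (s 0 * p (suc (suc n)))) (*ₚ-comm p (tailₚ s) (suc n)) ⟩
    s 0 * p (suc (suc n)) + (tailₚ s *ₚ p) (suc n)
      ∎
    where
    open ≡-Reasoning
    swap : ∀ a b c d x → a * b + (c * d + x) ≡ c * d + (a * b + x)
    swap = solve-∀

  *ₚ-mulXˡ : ∀ p s → mulX p *ₚ s ≗ mulX (p *ₚ s)
  *ₚ-mulXˡ p s zero    = *-zeroˡ (s 0)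
  *ₚ-mulXˡ p s (suc n) = trans (cong (_+ (p *ₚ s) n) (*-zeroˡ (s (suc n)))) (+-identityˡ _)

  *ₚ-mulXPowˡ : ∀ e p s → mulXPow e p *ₚ s ≗ mulXPow e (p *ₚ s)
  *ₚ-mulXPowˡ zero    p s n = refl
  *ₚ-mulXPowˡ (suc e) p s n = trans (*ₚ-mulXˡ (mulXPow e p) s n) (mulX-cong (*ₚ-mulXPowˡ e p s) n)

  *ₚ-mulXʳ : ∀ p s → p *ₚ mulX s ≗ mulX (p *ₚ s)
  *ₚ-mulXʳ p s n = trans (*ₚ-comm p (mulX s) n) (trans (*ₚ-mulXˡ s p n) (mulX-cong (*ₚ-comm s p) n))

  *ₚ-linearˡ : ∀ x y p p′ s → (λ i → x * p i + y * p′ i) *ₚ s ≗ (λ n → x * (p *ₚ s) n + y * (p′ *ₚ s) n)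
  *ₚ-linearˡ x y p p′ s zero    = distrib x y (p 0) (p′ 0) (s 0)
    where
    distrib : ∀ x y a b c → (x * a + y * b) * c ≡ x * (a * c) + y * (b * c)
    distrib = solve-∀
  *ₚ-linearˡ x y p p′ s (suc n) =
    trans (cong (_+_ ((x * p 0 + y * p′ 0) * s (suc n))) (*ₚ-linearˡ x y (tailₚ p) (tailₚ p′) s n))
          (distrib x y (p 0) (p′ 0) (s (suc n)) ((tailₚ p *ₚ s) n) ((tailₚ p′ *ₚ s) n))
    where
    distrib : ∀ x y a b c A B → (x * a + y * b) * c + (x * A + y * B) ≡ x * (a * c + A) + y * (b * c + B)
    distrib = solve-∀

  *ₚ-linearʳ : ∀ x y p s s′ → p *ₚ (λ i → x * s i + y * s′ i) ≗ (λ n → x * (p *ₚ s) n + y * (p *ₚ s′) n)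
  *ₚ-linearʳ x y p s s′ n =
    trans (*ₚ-comm p _ n)
      (trans (*ₚ-linearˡ x y s s′ p n)
        (cong₂ (λ a b → x * a + y * b) (*ₚ-comm s p n) (*ₚ-comm s′ p n)))

  *ₚ-mulLinearʳ : ∀ r p s → p *ₚ mulLinear r s ≗ mulLinear r (p *ₚ s)
  *ₚ-mulLinearʳ r p s n = begin
    (p *ₚ mulLinear r s) n                          ≡⟨ *ₚ-cong {p} (λ _ → refl) (λ i → as-combination (mulX s i) (s i) r) n ⟩
    (p *ₚ (λ i → + 1 * mulX s i + (- r) * s i)) n   ≡⟨ *ₚ-linearʳ (+ 1) (- r) p (mulX s) s n ⟩
    + 1 * (p *ₚ mulX s) n + (- r) * (p *ₚ s) n      ≡⟨ cong (λ a → + 1 * a + (- r) * (p *ₚ s) n) (*ₚ-mulXʳ p s n) ⟩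
    + 1 * mulX (p *ₚ s) n + (- r) * (p *ₚ s) n      ≡⟨ as-combination (mulX (p *ₚ s) n) ((p *ₚ s) n) r ⟨
    mulLinear r (p *ₚ s) n                          ∎
    where
    open ≡-Reasoning
    as-combination : ∀ a b r → a - r * b ≡ + 1 * a + (- r) * b
    as-combination = solve-∀

  *ₚ-mulLinearsʳ : ∀ rs p s → p *ₚ mulLinears rs s ≗ mulLinears rs (p *ₚ s)
  *ₚ-mulLinearsʳ []       p s n = refl
  *ₚ-mulLinearsʳ (r ∷ rs) p s n =
    trans (*ₚ-mulLinearʳ r p (mulLinears rs s) n) (mulLinear-cong r (*ₚ-mulLinearsʳ rs p s) n)

  mulLinear-linear : ∀ r c A B → mulLinear r (λ n → A n + c * B n) ≗ (λ n → mulLinear r A n + c * mulLinear r B n)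
  mulLinear-linear r c A B zero    = distrib (A 0) (B 0) r c
    where
    distrib : ∀ a b r c → + 0 - r * (a + c * b) ≡ (+ 0 - r * a) + c * (+ 0 - r * b)
    distrib = solve-∀
  mulLinear-linear r c A B (suc n) = distrib (A n) (B n) (A (suc n)) (B (suc n)) r c
    where
    distrib : ∀ a b a′ b′ r c → (a + c * b) - r * (a′ + c * b′) ≡ (a - r * a′) + c * (b - r * b′)
    distrib = solve-∀

  mulLinears-linear : ∀ rs c A B → mulLinears rs (λ n → A n + c * B n) ≗ (λ n → mulLinears rs A n + c * mulLinears rs B n)
  mulLinears-linear []       c A B n = refl
  mulLinears-linear (r ∷ rs) c A B n =
    trans (mulLinear-cong r (mulLinears-linear rs c A B) n) (mulLinear-linear r c (mulLinears rs A) (mulLinears rs B) n)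

  evalₚ : ℕ → Poly → ℤ → ℤ
  evalₚ zero    p x = p 0
  evalₚ (suc D) p x = p 0 + x * evalₚ D (tailₚ p) x

  -- Synthetic division of a polynomial of degree ≤ D + 1 by x - r.
  divLinear : ℕ → Poly → ℤ → Poly
  divLinear D       p r zero    = evalₚ D (tailₚ p) r
  divLinear zero    p r (suc i) = + 0
  divLinear (suc D) p r (suc i) = divLinear D (tailₚ p) r i

  divLinear-deg : ∀ D p r → Deg≤ D (divLinear D p r)
  divLinear-deg zero    p r (suc i) _         = refl
  divLinear-deg (suc D) p r (suc i) (s≤s D<i) = divLinear-deg D (tailₚ p) r i D<i

  divLinear-lead : ∀ D p r → divLinear D p r D ≡ p (suc D)
  divLinear-lead zero    p r = refl
  divLinear-lead (suc D) p r = divLinear-lead D (tailₚ p) r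

  divLinear-eval : ∀ D p r x → evalₚ (suc D) p x ≡ (x - r) * evalₚ D (divLinear D p r) x + evalₚ (suc D) p r
  divLinear-eval zero    p r x = rearrange x r (p 0) (p 1)
    where
    rearrange : ∀ x r p₀ p₁ → p₀ + x * p₁ ≡ (x - r) * p₁ + (p₀ + r * p₁)
    rearrange = solve-∀
  divLinear-eval (suc D) p r x =
    trans (cong (λ z → p 0 + x * z) (divLinear-eval D (tailₚ p) r x))
          (rearrange x r (p 0) (evalₚ D (divLinear D (tailₚ p) r) x) (evalₚ (suc D) (tailₚ p) r))
    where
    rearrange : ∀ x r p₀ w e → p₀ + x * ((x - r) * w + e) ≡ (x - r) * (e + x * w) + (p₀ + r * e)
    rearrange = solve-∀

  divLinear-coeff : ∀ D p r → Deg≤ (suc D) p →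
    p ≗ (λ n → mulLinear r (divLinear D p r) n + constₚ (evalₚ (suc D) p r) n)
  divLinear-coeff D p r deg zero = rearrange (p 0) r (evalₚ D (tailₚ p) r)
    where
    rearrange : ∀ p₀ r e → p₀ ≡ (+ 0 - r * e) + (p₀ + r * e)
    rearrange = solve-∀
  divLinear-coeff zero p r deg (suc zero) = rearrange (p 1) r
    where
    rearrange : ∀ p₁ r → p₁ ≡ (p₁ - r * + 0) + + 0
    rearrange = solve-∀
  divLinear-coeff zero p r deg (suc (suc n)) = trans (deg (suc (suc n)) (s≤s (s≤s z≤n))) (vanish r)
    where
    vanish : ∀ r → + 0 ≡ (+ 0 - r * + 0) + + 0
    vanish = solve-∀
  divLinear-coeff (suc D) p r deg (suc zero) =
    trans (divLinear-coeff D (tailₚ p) r (λ i D<i → deg (suc i) (s≤s D<i)) 0)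
          (rearrange r (divLinear D (tailₚ p) r 0) (evalₚ (suc D) (tailₚ p) r))
    where
    rearrange : ∀ r w e → (+ 0 - r * w) + e ≡ (e - r * w) + + 0
    rearrange = solve-∀
  divLinear-coeff (suc D) p r deg (suc (suc n)) =
    divLinear-coeff D (tailₚ p) r (λ i D<i → deg (suc i) (s≤s D<i)) (suc n)

  -- The factor theorem modulo a prime

  ∣0 : ∀ {k} → k ∣ + 0
  ∣0 = divides (+ 0) refl

  ∣-resp-≡ : ∀ {k a b} → a ≡ b → k ∣ a → k ∣ b
  ∣-resp-≡ refl k∣a = k∣a

  ∣-swap-sub : ∀ {k} a b → k ∣ a - b → k ∣ b - a
  ∣-swap-sub a b k∣a-b = ∣-resp-≡ (neg-sub a b) (∣m⇒∣-m k∣a-b)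
    where
    neg-sub : ∀ a b → - (a - b) ≡ b - a
    neg-sub = solve-∀

  prime-∣-* : ∀ {q} → Prime q → ∀ a b → + q ∣ a * b → + q ∣ a ⊎ + q ∣ b
  prime-∣-* q-prime a b q∣ab
    with euclidsLemma ℤ.∣ a ∣ ℤ.∣ b ∣ q-prime (subst (_ ℕ.∣_) (abs-* a b) (∣⇒∣ᵤ q∣ab))
  ... | inj₁ q∣a = inj₁ (∣ᵤ⇒∣ q∣a)
  ... | inj₂ q∣b = inj₂ (∣ᵤ⇒∣ q∣b)

  module _ (q : ℕ) where

    NonzeroMod : ℕ → Poly → Set
    NonzeroMod D p = ¬ (∀ i → i ℕ.≤ D → + q ∣ p i)

    DistinctMod : List ℤ → Set
    DistinctMod = AllPairs (λ a b → ¬ + q ∣ a - b)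

    record LinearFactorsMod (rs : List ℤ) (D : ℕ) (p : Poly) : Set where
      field
        length≤degree : length rs ℕ.≤ D
        cofactor      : Poly
        cofactor-deg  : Deg≤ (D ∸ length rs) cofactor
        cofactor-lead : cofactor (D ∸ length rs) ≡ p D
        error         : Poly
        factorization : p ≗ λ n → mulLinears rs cofactor n + + q * error n

    divLinear-nonzeroMod : ∀ D p r → Deg≤ (suc D) p → + q ∣ evalₚ (suc D) p r →
      NonzeroMod (suc D) p → NonzeroMod D (divLinear D p r)
    divLinear-nonzeroMod D p r deg q∣p[r] p≢0 quotient≡0 = p≢0 λ i i≤ →
      ∣-resp-≡ (sym (divLinear-coeff D p r deg i)) (coefficient i i≤)
      where
      Q : Poly
      Q = divLinear D p r
      coefficient : ∀ i → i ℕ.≤ suc D → + q ∣ mulLinear r Q i + constₚ (evalₚ (suc D) p r) i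
      coefficient zero    _ = ∣m∣n⇒∣m+n (∣m∣n⇒∣m-n ∣0 (∣n⇒∣m*n r (quotient≡0 0 z≤n))) q∣p[r]
      coefficient (suc i) (s≤s i≤D) with suc i ℕ.≤? D
      ... | yes i<D = ∣m∣n⇒∣m+n (∣m∣n⇒∣m-n (quotient≡0 i i≤D) (∣n⇒∣m*n r (quotient≡0 (suc i) i<D))) ∣0
      ... | no  i≮D = ∣m∣n⇒∣m+n (∣m∣n⇒∣m-n (quotient≡0 i i≤D)
                        (∣n⇒∣m*n r (∣-resp-≡ (sym (divLinear-deg D p r (suc i) (ℕ.≰⇒> i≮D))) ∣0))) ∣0

    module _ (q-prime : Prime q) where

      divLinear-roots : ∀ D p r → + q ∣ evalₚ (suc D) p r →
        ∀ {rs} → All (λ s → + q ∣ evalₚ (suc D) p s) rs → All (λ s → ¬ + q ∣ r - s) rs →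
        All (λ s → + q ∣ evalₚ D (divLinear D p r) s) rs
      divLinear-roots D p r q∣p[r] []                []                 = []
      divLinear-roots D p r q∣p[r] {s ∷ _} (q∣p[s] ∷ roots) (r≢s ∷ distinct)
        with prime-∣-* q-prime (s - r) (evalₚ D (divLinear D p r) s)
               (∣-resp-≡ (cancel (divLinear-eval D p r s)) (∣m∣n⇒∣m-n q∣p[s] q∣p[r]))
        where
        cancel : ∀ {A B C} → A ≡ B + C → A - C ≡ B
        cancel {A} {B} {C} refl = lemma B C
          where
          lemma : ∀ B C → (B + C) - C ≡ B
          lemma = solve-∀
      ... | inj₁ q∣s-r = ⊥-elim (r≢s (∣-swap-sub s r q∣s-r))
      ... | inj₂ q∣Q[s] = q∣Q[s] ∷ divLinear-roots D p r q∣p[r] roots distinct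

      linearFactorsMod : ∀ rs D p → Deg≤ D p → All (λ r → + q ∣ evalₚ D p r) rs → DistinctMod rs →
        NonzeroMod D p → LinearFactorsMod rs D p
      linearFactorsMod [] D p deg _ _ _ = record
        { length≤degree = z≤n ; cofactor = p ; cofactor-deg = deg ; cofactor-lead = refl
        ; error = λ _ → + 0 ; factorization = λ n → sym (trans (cong (_+_ (p n)) (*-zeroʳ (+ q))) (+-identityʳ (p n))) }
      linearFactorsMod (r ∷ rs) zero p deg (q∣p[r] ∷ _) _ p≢0 = ⊥-elim (p≢0 λ { zero _ → q∣p[r] })
      linearFactorsMod (r ∷ rs) (suc D) p deg (q∣p[r] ∷ roots) (r≢rs ∷ distinct) p≢0 = record
        { length≤degree = s≤s length≤degree
        ; cofactor = cofactor
        ; cofactor-deg = cofactor-deg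
        ; cofactor-lead = trans cofactor-lead (divLinear-lead D p r)
        ; error = λ n → mulLinear r error n + constₚ c n
        ; factorization = factorization′
        }
        where
        Q : Poly
        Q = divLinear D p r
        open LinearFactorsMod (linearFactorsMod rs D Q (divLinear-deg D p r)
          (divLinear-roots D p r q∣p[r] roots r≢rs) distinct (divLinear-nonzeroMod D p r deg q∣p[r] p≢0))
        c : ℤ
        c = _∣_.quotient q∣p[r]
        constₚ-scale : ∀ n → constₚ (c * + q) n ≡ + q * constₚ c n
        constₚ-scale zero    = *-comm c (+ q)
        constₚ-scale (suc n) = sym (*-zeroʳ (+ q))
        factorization′ : p ≗ λ n → mulLinears (r ∷ rs) cofactor n + + q * (mulLinear r error n + constₚ c n)
        factorization′ n = begin
          p n
            ≡⟨ divLinear-coeff D p r deg n ⟩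
          mulLinear r Q n + constₚ (evalₚ (suc D) p r) n
            ≡⟨ cong₂ _+_ (trans (mulLinear-cong r factorization n) (mulLinear-linear r (+ q) (mulLinears rs cofactor) error n))
                         (trans (cong (λ z → constₚ z n) (_∣_.equality q∣p[r])) (constₚ-scale n)) ⟩
          (mulLinears (r ∷ rs) cofactor n + + q * mulLinear r error n) + + q * constₚ c n
            ≡⟨ collect (mulLinears (r ∷ rs) cofactor n) (mulLinear r error n) (constₚ c n) (+ q) ⟩
          mulLinears (r ∷ rs) cofactor n + + q * (mulLinear r error n + constₚ c n)
            ∎
          where
          open ≡-Reasoning
          collect : ∀ L A C q → (L + q * A) + q * C ≡ L + q * (A + C)
          collect = solve-∀

      roots≤degree : ∀ {rs D p} → Deg≤ D p → All (λ r → + q ∣ evalₚ D p r) rs → DistinctMod rs →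
        NonzeroMod D p → length rs ℕ.≤ D
      roots≤degree {rs} {D} {p} deg roots distinct p≢0 =
        LinearFactorsMod.length≤degree (linearFactorsMod rs D p deg roots distinct p≢0)

  -- Rows of the Sylvester matrix

  mulXPow-below : ∀ e (p : Poly) P → P ℕ.< e → mulXPow e p P ≡ + 0
  mulXPow-below (suc e) p zero    _         = refl
  mulXPow-below (suc e) p (suc P) (s≤s P<e) = mulXPow-below e p P P<e

  mulXPow-shifted : ∀ e (p : Poly) u → mulXPow e p (e ℕ.+ u) ≡ p u
  mulXPow-shifted zero    p u = refl
  mulXPow-shifted (suc e) p u = mulXPow-shifted e p u

  mulXPow-deg : ∀ e D (p : Poly) → Deg≤ D p → Deg≤ (e ℕ.+ D) (mulXPow e p)
  mulXPow-deg zero    D p deg = deg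
  mulXPow-deg (suc e) D p deg (suc i) (s≤s e+D<i) = mulXPow-deg e D p deg i e+D<i

  coeff-deg : ∀ d c → Deg≤ d (coeff d c)
  coeff-deg d c u d<u with u ℕ.<? suc d
  ... | yes u≤d = ⊥-elim (ℕ.<-irrefl refl (ℕ.<-≤-trans d<u (ℕ.≤-pred u≤d)))
  ... | no  _   = refl

  coeff-toℕ : ∀ d c (i : Fin (suc d)) → coeff d c (toℕ i) ≡ c i
  coeff-toℕ d c i with toℕ i ℕ.<? suc d
  ... | yes i<d = cong c (Fin.fromℕ<-toℕ i i<d)
  ... | no  i≮d = ⊥-elim (i≮d (Fin.toℕ<n i))

  -- Row sh of a block is x^sh·c read from the top degree down; P + j ≡ e + (d + sh) says that
  -- column j holds the coefficient of x^P in x^e·c.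
  sylEntry≡mulXPow-coeff : ∀ d c sh j e P → P ℕ.+ j ≡ e ℕ.+ (d ℕ.+ sh) →
    sylEntry d c sh j ≡ mulXPow e (coeff d c) P
  sylEntry≡mulXPow-coeff d c sh j e P eq with sh ℕ.≤? j
  ... | yes sh≤j with j ∸ sh ℕ.≤? d
  ...   | yes v≤d = sym (trans (cong (mulXPow e (coeff d c)) P≡e+u) (mulXPow-shifted e (coeff d c) u))
    where
    v u : ℕ
    v = j ∸ sh
    u = d ∸ v
    sh+v≡j : sh ℕ.+ v ≡ j
    sh+v≡j = ℕ.m+[n∸m]≡n sh≤j
    v+u≡d : v ℕ.+ u ≡ d
    v+u≡d = ℕ.m+[n∸m]≡n v≤d
    rearrange : ∀ e v u sh → e ℕ.+ ((v ℕ.+ u) ℕ.+ sh) ≡ (e ℕ.+ u) ℕ.+ (sh ℕ.+ v)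
    rearrange = ℕ-solve-∀
    P≡e+u : P ≡ e ℕ.+ u
    P≡e+u = ℕ.+-cancelʳ-≡ (sh ℕ.+ v) P (e ℕ.+ u)
      (trans (cong (P ℕ.+_) sh+v≡j) (trans eq (trans (cong (λ z → e ℕ.+ (z ℕ.+ sh)) (sym v+u≡d)) (rearrange e v u sh))))
  ...   | no  v≰d = sym (mulXPow-below e (coeff d c) P P<e)
    where
    v : ℕ
    v = j ∸ sh
    rearrange₁ : ∀ P sh v → P ℕ.+ (sh ℕ.+ v) ≡ (P ℕ.+ v) ℕ.+ sh
    rearrange₁ = ℕ-solve-∀
    rearrange₂ : ∀ e d sh → e ℕ.+ (d ℕ.+ sh) ≡ (e ℕ.+ d) ℕ.+ sh
    rearrange₂ = ℕ-solve-∀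
    P+v≡e+d : P ℕ.+ v ≡ e ℕ.+ d
    P+v≡e+d = ℕ.+-cancelʳ-≡ sh _ _
      (trans (sym (rearrange₁ P sh v)) (trans (cong (P ℕ.+_) (ℕ.m+[n∸m]≡n sh≤j)) (trans eq (rearrange₂ e d sh))))
    P<e : P ℕ.< e
    P<e with P ℕ.<? e
    ... | yes P<e = P<e
    ... | no  P≮e = ⊥-elim (ℕ.<-irrefl (sym P+v≡e+d)
                      (ℕ.<-≤-trans (ℕ.+-monoʳ-< e (ℕ.≰⇒> v≰d)) (ℕ.+-monoˡ-≤ v (ℕ.≮⇒≥ P≮e))))
  sylEntry≡mulXPow-coeff d c sh j e P eq | no j<sh with P ℕ.<? e
  ... | yes P<e = sym (mulXPow-below e (coeff d c) P P<e)
  ... | no  P≮e = sym (trans (cong (mulXPow e (coeff d c)) (sym e+u≡P))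
                   (trans (mulXPow-shifted e (coeff d c) u) (coeff-deg d c u d<u)))
    where
    u : ℕ
    u = P ∸ e
    e+u≡P : e ℕ.+ u ≡ P
    e+u≡P = ℕ.m+[n∸m]≡n (ℕ.≮⇒≥ P≮e)
    reassoc : ∀ e u j → (e ℕ.+ u) ℕ.+ j ≡ e ℕ.+ (u ℕ.+ j)
    reassoc = ℕ-solve-∀
    u+j≡d+sh : u ℕ.+ j ≡ d ℕ.+ sh
    u+j≡d+sh = ℕ.+-cancelˡ-≡ e _ _ (trans (sym (reassoc e u j)) (trans (cong (ℕ._+ j) e+u≡P) eq))
    d<u : d ℕ.< u
    d<u with d ℕ.<? u
    ... | yes d<u = d<u
    ... | no  d≮u = ⊥-elim (ℕ.<-irrefl u+j≡d+sh (ℕ.+-mono-≤-< (ℕ.≮⇒≥ d≮u) (ℕ.≰⇒> j<sh)))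

  sumUpTo : ℕ → Poly → ℤ
  sumUpTo zero    t = + 0
  sumUpTo (suc k) t = t 0 + sumUpTo k (tailₚ t)

  sum-toℕ : ∀ k (t : Poly) → sum {k} (t ∘ toℕ) ≡ sumUpTo k t
  sum-toℕ zero    t = refl
  sum-toℕ (suc k) t = cong (_+_ (t 0)) (sum-toℕ k (tailₚ t))

  sumUpTo-cong : ∀ k (t t′ : Poly) → (∀ i → i ℕ.< k → t i ≡ t′ i) → sumUpTo k t ≡ sumUpTo k t′
  sumUpTo-cong zero    t t′ t≡ = refl
  sumUpTo-cong (suc k) t t′ t≡ = cong₂ _+_ (t≡ 0 (s≤s z≤n)) (sumUpTo-cong k (tailₚ t) (tailₚ t′) (λ i i<k → t≡ (suc i) (s≤s i<k)))

  sumUpTo-snoc : ∀ k t → sumUpTo (suc k) t ≡ sumUpTo k t + t k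
  sumUpTo-snoc zero    t = trans (+-identityʳ (t 0)) (sym (+-identityˡ (t 0)))
  sumUpTo-snoc (suc k) t =
    trans (cong (_+_ (t 0)) (sumUpTo-snoc k (tailₚ t))) (sym (+-assoc (t 0) (sumUpTo k (tailₚ t)) (t (suc k))))

  sumUpTo-reverse : ∀ k t → sumUpTo k (λ i → t (k ∸ suc i)) ≡ sumUpTo k t
  sumUpTo-reverse zero    t = refl
  sumUpTo-reverse (suc k) t = trans (cong (_+_ (t k)) (sumUpTo-reverse k t))
    (trans (+-comm (t k) (sumUpTo k t)) (sym (sumUpTo-snoc k t)))

  sumUpTo-zero : ∀ k t → (∀ i → t i ≡ + 0) → sumUpTo k t ≡ + 0
  sumUpTo-zero zero    t t≡0 = refl
  sumUpTo-zero (suc k) t t≡0 = cong₂ _+_ (t≡0 0) (sumUpTo-zero k (tailₚ t) (t≡0 ∘ suc))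

  sumUpTo-beyondSupport : ∀ K B t → K ℕ.≤ B → (∀ e → K ℕ.≤ e → t e ≡ + 0) → sumUpTo B t ≡ sumUpTo K t
  sumUpTo-beyondSupport zero    B       t _         t≡0 = sumUpTo-zero B t (λ i → t≡0 i z≤n)
  sumUpTo-beyondSupport (suc K) (suc B) t (s≤s K≤B) t≡0 =
    cong (_+_ (t 0)) (sumUpTo-beyondSupport K B (tailₚ t) K≤B (λ i K≤i → t≡0 (suc i) (s≤s K≤i)))

  *ₚ-as-sum : ∀ p s n → (p *ₚ s) n ≡ sumUpTo (suc n) (λ e → p e * mulXPow e s n)
  *ₚ-as-sum p s zero    = sym (+-identityʳ (p 0 * s 0))
  *ₚ-as-sum p s (suc n) = cong (_+_ (p 0 * s (suc n))) (*ₚ-as-sum (tailₚ p) s n)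

  *ₚ-as-sumUpTo : ∀ K p s n → (∀ e → K ℕ.≤ e → p e ≡ + 0) →
    (p *ₚ s) n ≡ sumUpTo K (λ e → p e * mulXPow e s n)
  *ₚ-as-sumUpTo K p s n p≡0 with K ℕ.≤? suc n
  ... | yes K≤n = trans (*ₚ-as-sum p s n) (sumUpTo-beyondSupport K (suc n) _ K≤n
                    (λ e K≤e → trans (cong (_* mulXPow e s n) (p≡0 e K≤e)) (*-zeroˡ (mulXPow e s n))))
  ... | no  K≰n = trans (*ₚ-as-sum p s n) (sym (sumUpTo-beyondSupport (suc n) K _ (ℕ.<⇒≤ (ℕ.≰⇒> K≰n))
                    (λ e n<e → trans (cong (p e *_) (mulXPow-below e s n n<e)) (*-zeroʳ (p e)))))

  sylBlock-combination : ∀ K d c (W : Poly) → (∀ e → K ℕ.≤ e → W e ≡ + 0) → ∀ j P → suc (P ℕ.+ j) ≡ K ℕ.+ d →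
    sum {K} (λ i → W (K ∸ suc (toℕ i)) * sylEntry d c (toℕ i) j) ≡ (W *ₚ coeff d c) P
  sylBlock-combination K d c W W≡0 j P P+j<K+d = begin
    sum {K} (λ i → W (K ∸ suc (toℕ i)) * sylEntry d c (toℕ i) j)
      ≡⟨ sum-toℕ K (λ i → W (K ∸ suc i) * sylEntry d c i j) ⟩
    sumUpTo K (λ i → W (K ∸ suc i) * sylEntry d c i j)
      ≡⟨ sumUpTo-cong K _ (λ i → t (K ∸ suc i)) entry≡ ⟩
    sumUpTo K (λ i → t (K ∸ suc i))
      ≡⟨ sumUpTo-reverse K t ⟩
    sumUpTo K t
      ≡⟨ *ₚ-as-sumUpTo K W (coeff d c) P W≡0 ⟨
    (W *ₚ coeff d c) P
      ∎
    where
    open ≡-Reasoning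
    t : Poly
    t e = W e * mulXPow e (coeff d c) P
    rearrange : ∀ i w d → suc i ℕ.+ w ℕ.+ d ≡ suc (w ℕ.+ (d ℕ.+ i))
    rearrange = ℕ-solve-∀
    entry≡ : ∀ i → i ℕ.< K → W (K ∸ suc i) * sylEntry d c i j ≡ t (K ∸ suc i)
    entry≡ i i<K = cong (W (K ∸ suc i) *_) (sylEntry≡mulXPow-coeff d c i j (K ∸ suc i) P
      (ℕ.suc-injective (trans P+j<K+d (trans (cong (ℕ._+ d) (sym (ℕ.m+[n∸m]≡n i<K))) (rearrange i (K ∸ suc i) d)))))

  sum-↑ : ∀ m n (h : Fin (m ℕ.+ n) → ℤ) → sum h ≡ sum (λ i → h (i ↑ˡ n)) + sum (λ i → h (m ↑ʳ i))
  sum-↑ zero    n h = sym (+-identityˡ (sum h))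
  sum-↑ (suc m) n h = trans (cong (_+_ (h zero)) (sum-↑ m n (h ∘ suc)))
    (sym (+-assoc (h zero) (sum (λ i → h (suc i ↑ˡ n))) (sum (λ i → h (suc m ↑ʳ i)))))

  sylWeights : ∀ m n → Poly → Poly → Fin (m ℕ.+ n) → ℤ
  sylWeights m n U V r with splitAt m r
  ... | inj₁ i = U (m ∸ suc (toℕ i))
  ... | inj₂ i = V (n ∸ suc (toℕ i))

  sylWeights-↑ˡ : ∀ m n U V (i : Fin m) → sylWeights m n U V (i ↑ˡ n) ≡ U (m ∸ suc (toℕ i))
  sylWeights-↑ˡ m n U V i rewrite Fin.splitAt-↑ˡ m i n = refl

  sylWeights-↑ʳ : ∀ m n U V (i : Fin n) → sylWeights m n U V (m ↑ʳ i) ≡ V (n ∸ suc (toℕ i))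
  sylWeights-↑ʳ m n U V i rewrite Fin.splitAt-↑ʳ m n i = refl

  sylvester-↑ˡ : ∀ n m a g (i : Fin m) j → sylvester n m a g (i ↑ˡ n) j ≡ sylEntry n a (toℕ i) (toℕ j)
  sylvester-↑ˡ n m a g i j rewrite Fin.splitAt-↑ˡ m i n = refl

  sylvester-↑ʳ : ∀ n m a g (i : Fin n) j → sylvester n m a g (m ↑ʳ i) j ≡ sylEntry m g (toℕ i) (toℕ j)
  sylvester-↑ʳ n m a g i j rewrite Fin.splitAt-↑ʳ m n i = refl

  -- Column j of the Sylvester matrix holds the coefficients of x^(m + n - 1 - j).
  columnDegree : ∀ m n → Fin (m ℕ.+ n) → ℕ
  columnDegree m n j = (m ℕ.+ n) ∸ suc (toℕ j)

  columnDegree-+ : ∀ m n (j : Fin (m ℕ.+ n)) → suc (columnDegree m n j ℕ.+ toℕ j) ≡ m ℕ.+ n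
  columnDegree-+ m n j = trans (sym (ℕ.+-suc (columnDegree m n j) (toℕ j))) (ℕ.m∸n+n≡m (Fin.toℕ<n j))

  sylvester-combination : ∀ n m a g U V → (∀ e → m ℕ.≤ e → U e ≡ + 0) → (∀ e → n ℕ.≤ e → V e ≡ + 0) →
    ∀ j → sum (λ r → sylWeights m n U V r * sylvester n m a g r j)
          ≡ (U *ₚ coeff n a) (columnDegree m n j) + (V *ₚ coeff m g) (columnDegree m n j)
  sylvester-combination n m a g U V U≡0 V≡0 j =
    trans (sum-↑ m n (λ r → sylWeights m n U V r * sylvester n m a g r j))
     (cong₂ _+_
       (trans (sum-cong-≗ (λ i → cong₂ _*_ (sylWeights-↑ˡ m n U V i) (sylvester-↑ˡ n m a g i j)))
              (sylBlock-combination m n a U U≡0 (toℕ j) (columnDegree m n j) (columnDegree-+ m n j)))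
       (trans (sum-cong-≗ (λ i → cong₂ _*_ (sylWeights-↑ʳ m n U V i) (sylvester-↑ʳ n m a g i j)))
              (sylBlock-combination n m g V V≡0 (toℕ j) (columnDegree m n j)
                (trans (columnDegree-+ m n j) (ℕ.+-comm m n)))))

  -- Common factors modulo q divide the resultant

  *ₚ-negˡ : ∀ p s → (λ i → - p i) *ₚ s ≗ (λ n → - (p *ₚ s) n)
  *ₚ-negˡ p s zero    = sym (neg-distribˡ-* (p 0) (s 0))
  *ₚ-negˡ p s (suc n) = trans (cong₂ _+_ (sym (neg-distribˡ-* (p 0) (s (suc n)))) (*ₚ-negˡ (tailₚ p) s n))
    (sym (neg-distrib-+ (p 0 * s (suc n)) ((tailₚ p *ₚ s) n)))

  mulXPow-+ : ∀ d (A B : Poly) P → mulXPow d A P + mulXPow d B P ≡ mulXPow d (λ n → A n + B n) P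
  mulXPow-+ zero    A B P       = refl
  mulXPow-+ (suc d) A B zero    = refl
  mulXPow-+ (suc d) A B (suc P) = mulXPow-+ d A B P

  mulXPow-scale : ∀ d x (A : Poly) P → mulXPow d (λ n → x * A n) P ≡ x * mulXPow d A P
  mulXPow-scale zero    x A P       = refl
  mulXPow-scale (suc d) x A zero    = sym (*-zeroʳ x)
  mulXPow-scale (suc d) x A (suc P) = mulXPow-scale d x A P

  *ₚ-factorization : ∀ q rs p s t E → s ≗ (λ i → mulLinears rs t i + + q * E i) →
    p *ₚ s ≗ (λ n → mulLinears rs (p *ₚ t) n + + q * (p *ₚ E) n)
  *ₚ-factorization q rs p s t E s≗ n = begin
    (p *ₚ s) n
      ≡⟨ *ₚ-cong {p} (λ _ → refl) (λ i → trans (s≗ i) (cong (λ z → z + + q * E i) (sym (*-identityˡ (mulLinears rs t i))))) n ⟩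
    (p *ₚ (λ i → + 1 * mulLinears rs t i + + q * E i)) n
      ≡⟨ *ₚ-linearʳ (+ 1) (+ q) p (mulLinears rs t) E n ⟩
    + 1 * (p *ₚ mulLinears rs t) n + + q * (p *ₚ E) n
      ≡⟨ cong (λ z → z + + q * (p *ₚ E) n) (trans (*-identityˡ ((p *ₚ mulLinears rs t) n)) (*ₚ-mulLinearsʳ rs p t n)) ⟩
    mulLinears rs (p *ₚ t) n + + q * (p *ₚ E) n
      ∎
    where open ≡-Reasoning

  cofactor-cross : ∀ q rs f g f′ g′ Ef Eg →
    f ≗ (λ i → mulLinears rs f′ i + + q * Ef i) → g ≗ (λ i → mulLinears rs g′ i + + q * Eg i) →
    ∀ n → (g′ *ₚ f) n + ((λ i → - f′ i) *ₚ g) n ≡ + q * ((g′ *ₚ Ef) n - (f′ *ₚ Eg) n)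
  cofactor-cross q rs f g f′ g′ Ef Eg f≗ g≗ n = begin
    (g′ *ₚ f) n + ((λ i → - f′ i) *ₚ g) n
      ≡⟨ cong₂ _+_ (*ₚ-factorization q rs g′ f f′ Ef f≗ n)
                   (trans (*ₚ-negˡ f′ g n) (cong -_ (*ₚ-factorization q rs f′ g g′ Eg g≗ n))) ⟩
    (mulLinears rs (g′ *ₚ f′) n + + q * (g′ *ₚ Ef) n) + - (mulLinears rs (f′ *ₚ g′) n + + q * (f′ *ₚ Eg) n)
      ≡⟨ cong (λ z → (z + + q * (g′ *ₚ Ef) n) + - (mulLinears rs (f′ *ₚ g′) n + + q * (f′ *ₚ Eg) n))
              (mulLinears-cong rs (*ₚ-comm g′ f′) n) ⟩
    (mulLinears rs (f′ *ₚ g′) n + + q * (g′ *ₚ Ef) n) + - (mulLinears rs (f′ *ₚ g′) n + + q * (f′ *ₚ Eg) n)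
      ≡⟨ cancel (mulLinears rs (f′ *ₚ g′) n) ((g′ *ₚ Ef) n) ((f′ *ₚ Eg) n) (+ q) ⟩
    + q * ((g′ *ₚ Ef) n - (f′ *ₚ Eg) n)
      ∎
    where
    open ≡-Reasoning
    cancel : ∀ L a b q → (L + q * a) + - (L + q * b) ≡ q * (a - b)
    cancel = solve-∀

  module _ (q : ℕ) {n m : ℕ} (a : Fin (suc n) → ℤ) (g : Fin (suc m) → ℤ) {rs : List ℤ}
    (fFactors : LinearFactorsMod q rs n (coeff n a)) (gFactors : LinearFactorsMod q rs m (coeff m g))
    (g-monic : coeff m g m ≡ + 1) where

    private
      module F = LinearFactorsMod fFactors
      module G = LinearFactorsMod gFactors
      k N : ℕ
      k = length rs
      N = m ℕ.+ n
      S : Matrix N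
      S = sylvester n m a g

    ReducedBelow : ℕ → Matrix N → Set
    ReducedBelow s M = (∀ (i : Fin m) → s ℕ.≤ toℕ i → ∀ c → M (i ↑ˡ n) c ≡ S (i ↑ˡ n) c)
                     × (∀ (i : Fin n) c → M (m ↑ʳ i) c ≡ S (m ↑ʳ i) c)

    -- Row s gets the leading coefficient 1 of g′ as weight, and the rows below s (already
    -- replaced) get weight 0.
    module Reduction (d s : ℕ) (s+d+1≡k : s ℕ.+ suc d ≡ k) where

      U V W : Poly
      U = mulXPow d G.cofactor
      V = mulXPow d (λ i → - F.cofactor i)
      W = mulXPow d (λ i → (G.cofactor *ₚ F.error) i - (F.cofactor *ₚ G.error) i)

      UV-combination : ∀ P → (U *ₚ coeff n a) P + (V *ₚ coeff m g) P ≡ + q * W P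
      UV-combination P = begin
        (U *ₚ coeff n a) P + (V *ₚ coeff m g) P
          ≡⟨ cong₂ _+_ (*ₚ-mulXPowˡ d G.cofactor (coeff n a) P) (*ₚ-mulXPowˡ d (λ i → - F.cofactor i) (coeff m g) P) ⟩
        mulXPow d (G.cofactor *ₚ coeff n a) P + mulXPow d ((λ i → - F.cofactor i) *ₚ coeff m g) P
          ≡⟨ mulXPow-+ d (G.cofactor *ₚ coeff n a) ((λ i → - F.cofactor i) *ₚ coeff m g) P ⟩
        mulXPow d (λ i → (G.cofactor *ₚ coeff n a) i + ((λ j → - F.cofactor j) *ₚ coeff m g) i) P
          ≡⟨ mulXPow-cong d (cofactor-cross q rs (coeff n a) (coeff m g) F.cofactor G.cofactor F.error G.error
               F.factorization G.factorization) P ⟩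
        mulXPow d (λ i → + q * ((G.cofactor *ₚ F.error) i - (F.cofactor *ₚ G.error) i)) P
          ≡⟨ mulXPow-scale d (+ q) (λ i → (G.cofactor *ₚ F.error) i - (F.cofactor *ₚ G.error) i) P ⟩
        + q * W P
          ∎
        where open ≡-Reasoning

      sizes : ∀ {x} → k ℕ.≤ x → suc s ℕ.+ (d ℕ.+ (x ∸ k)) ≡ x
      sizes {x} k≤x = trans (rearrange s d (x ∸ k)) (trans (cong (ℕ._+ (x ∸ k)) s+d+1≡k) (ℕ.m+[n∸m]≡n k≤x))
        where
        rearrange : ∀ s d w → suc s ℕ.+ (d ℕ.+ w) ≡ (s ℕ.+ suc d) ℕ.+ w
        rearrange = ℕ-solve-∀

      below : ∀ {x} → k ℕ.≤ x → d ℕ.+ (x ∸ k) ℕ.< x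
      below {x} k≤x = subst (d ℕ.+ (x ∸ k) ℕ.<_) (sizes k≤x) (s≤s (ℕ.m≤n+m _ s))

      U≡0 : ∀ e → m ℕ.≤ e → U e ≡ + 0
      U≡0 e m≤e = mulXPow-deg d (m ∸ k) G.cofactor G.cofactor-deg e (ℕ.<-≤-trans (below G.length≤degree) m≤e)

      V≡0 : ∀ e → n ℕ.≤ e → V e ≡ + 0
      V≡0 e n≤e = mulXPow-deg d (n ∸ k) (λ i → - F.cofactor i) (λ i lt → cong -_ (F.cofactor-deg i lt)) e
        (ℕ.<-≤-trans (below F.length≤degree) n≤e)

      s<m : s ℕ.< m
      s<m = subst (s ℕ.<_) (sizes G.length≤degree) (s≤s (ℕ.m≤m+n s _))

      m∸[1+s]≡ : m ∸ suc s ≡ d ℕ.+ (m ∸ k)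
      m∸[1+s]≡ = trans (cong (_∸ suc s) (sym (sizes G.length≤degree))) (ℕ.m+n∸m≡n (suc s) _)

      i₀ : Fin N
      i₀ = fromℕ< s<m ↑ˡ n

      toℕ-i₀ : toℕ i₀ ≡ s
      toℕ-i₀ = trans (Fin.toℕ-↑ˡ (fromℕ< s<m) n) (Fin.toℕ-fromℕ< s<m)

      weights : Fin N → ℤ
      weights = sylWeights m n U V

      weight-i₀ : weights i₀ ≡ + 1
      weight-i₀ = begin
        weights i₀                          ≡⟨ sylWeights-↑ˡ m n U V (fromℕ< s<m) ⟩
        U (m ∸ suc (toℕ (fromℕ< s<m)))      ≡⟨ cong (λ z → U (m ∸ suc z)) (Fin.toℕ-fromℕ< s<m) ⟩
        U (m ∸ suc s)                       ≡⟨ cong U m∸[1+s]≡ ⟩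
        U (d ℕ.+ (m ∸ k))                   ≡⟨ mulXPow-shifted d G.cofactor (m ∸ k) ⟩
        G.cofactor (m ∸ k)                  ≡⟨ trans G.cofactor-lead g-monic ⟩
        + 1                                 ∎
        where open ≡-Reasoning

      weight-replaced : ∀ (i : Fin m) → toℕ i ℕ.< s → weights (i ↑ˡ n) ≡ + 0
      weight-replaced i i<s = trans (sylWeights-↑ˡ m n U V i)
        (mulXPow-deg d (m ∸ k) G.cofactor G.cofactor-deg _
          (subst (ℕ._< m ∸ suc (toℕ i)) m∸[1+s]≡ (ℕ.∸-monoʳ-< (s≤s i<s) s<m)))

      newRow : Fin N → ℤ
      newRow c = W (columnDegree m n c)

      combination-S : ∀ c → sum (λ r → weights r * S r c) ≡ + q * newRow c
      combination-S c =
        trans (sylvester-combination n m a g U V U≡0 V≡0 c) (UV-combination (columnDegree m n c))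

      module _ (M : Matrix N) where

        combination-M≡S : ReducedBelow s M → ∀ c → sum (λ r → weights r * M r c) ≡ sum (λ r → weights r * S r c)
        combination-M≡S (fRowsOf , gRowsOf) c = begin
          sum (λ r → weights r * M r c)
            ≡⟨ sum-↑ m n (λ r → weights r * M r c) ⟩
          sum (λ i → weights (i ↑ˡ n) * M (i ↑ˡ n) c) + sum (λ i → weights (m ↑ʳ i) * M (m ↑ʳ i) c)
            ≡⟨ cong₂ _+_ (sum-cong-≗ fRow) (sum-cong-≗ (λ i → cong (weights (m ↑ʳ i) *_) (gRowsOf i c))) ⟩
          sum (λ i → weights (i ↑ˡ n) * S (i ↑ˡ n) c) + sum (λ i → weights (m ↑ʳ i) * S (m ↑ʳ i) c)
            ≡⟨ sum-↑ m n (λ r → weights r * S r c) ⟨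
          sum (λ r → weights r * S r c)
            ∎
          where
          open ≡-Reasoning
          fRow : ∀ i → weights (i ↑ˡ n) * M (i ↑ˡ n) c ≡ weights (i ↑ˡ n) * S (i ↑ˡ n) c
          fRow i with s ℕ.≤? toℕ i
          ... | yes s≤i = cong (weights (i ↑ˡ n) *_) (fRowsOf i s≤i c)
          ... | no  s≰i = trans (cong (_* M (i ↑ˡ n) c) w≡0)
                            (trans (*-zeroˡ (M (i ↑ˡ n) c)) (sym (trans (cong (_* S (i ↑ˡ n) c) w≡0) (*-zeroˡ (S (i ↑ˡ n) c)))))
            where
            w≡0 : weights (i ↑ˡ n) ≡ + 0
            w≡0 = weight-replaced i (ℕ.≰⇒> s≰i)

        M′ : Matrix N
        M′ = replaceRow M i₀ newRow

        det≡q*det : ReducedBelow s M → det N M ≡ + q * det N M′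
        det≡q*det M-reduced = begin
          det N M              ≡⟨ *-identityˡ (det N M) ⟨
          + 1 * det N M        ≡⟨ cong (_* det N M) weight-i₀ ⟨
          weights i₀ * det N M ≡⟨ det-rowCombination N M A i₀ weights (replaceRow-minimal M i₀ _) (replaceRow-updates M i₀ _) ⟨
          det N A              ≡⟨ det-scaleRow N A M′ i₀ (+ q)
                                    (λ r r≢i₀ c → trans (replaceRow-minimal M i₀ _ r r≢i₀ c) (sym (replaceRow-minimal M i₀ newRow r r≢i₀ c)))
                                    (λ c → trans (replaceRow-updates M i₀ _ c)
                                             (trans (combination-M≡S M-reduced c)
                                               (trans (combination-S c) (cong (+ q *_) (sym (replaceRow-updates M i₀ newRow c)))))) ⟩
          + q * det N M′       ∎
          where
          open ≡-Reasoning
          A : Matrix N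
          A = replaceRow M i₀ (λ c → sum (λ r → weights r * M r c))

        M′-reduced : ReducedBelow s M → ReducedBelow (suc s) M′
        M′-reduced (fRowsOf , gRowsOf) = fRows , gRows
          where
          fRows : ∀ (i : Fin m) → suc s ℕ.≤ toℕ i → ∀ c → M′ (i ↑ˡ n) c ≡ S (i ↑ˡ n) c
          fRows i s<i c = trans (replaceRow-minimal M i₀ newRow (i ↑ˡ n) i≢i₀ c) (fRowsOf i (ℕ.<⇒≤ s<i) c)
            where
            i≢i₀ : i ↑ˡ n ≢ i₀
            i≢i₀ eq = ℕ.<-irrefl (trans (sym toℕ-i₀) (trans (cong toℕ (sym eq)) (Fin.toℕ-↑ˡ i n))) s<i
          gRows : ∀ (i : Fin n) c → M′ (m ↑ʳ i) c ≡ S (m ↑ʳ i) c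
          gRows i c = trans (replaceRow-minimal M i₀ newRow (m ↑ʳ i) i≢i₀ c) (gRowsOf i c)
            where
            i≢i₀ : m ↑ʳ i ≢ i₀
            i≢i₀ eq = ℕ.<-irrefl (sym (trans (cong toℕ eq) toℕ-i₀))
              (ℕ.<-≤-trans s<m (subst (m ℕ.≤_) (sym (Fin.toℕ-↑ʳ m i)) (ℕ.m≤m+n m (toℕ i))))

    reduce : ∀ d s → s ℕ.+ d ≡ k → ∀ M → ReducedBelow s M → (+ q) ^ d ∣ det N M
    reduce zero    s _       M _         = divides (det N M) (sym (*-identityʳ (det N M)))
    reduce (suc d) s s+d+1≡k M M-reduced = ∣-resp-≡ (sym (det≡q*det M M-reduced))
      (*-monoʳ-∣ (+ q) (reduce d (suc s) (trans (sym (ℕ.+-suc s d)) s+d+1≡k) (M′ M) (M′-reduced M M-reduced)))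
      where open Reduction d s s+d+1≡k

    resultant-divisible : (+ q) ^ length rs ∣ resultant n m a g
    resultant-divisible = reduce k 0 refl S ((λ _ _ _ → refl) , (λ _ _ → refl))

  -- Evaluation

  evalₚ-as-sumUpTo : ∀ D (p : Poly) x → evalₚ D p x ≡ sumUpTo (suc D) (λ i → p i * x ^ i)
  evalₚ-as-sumUpTo zero    p x = sym (trans (+-identityʳ (p 0 * + 1)) (*-identityʳ (p 0)))
  evalₚ-as-sumUpTo (suc D) p x = cong₂ _+_ (sym (*-identityʳ (p 0))) (begin
    x * evalₚ D (tailₚ p) x                                   ≡⟨ cong (x *_) (evalₚ-as-sumUpTo D (tailₚ p) x) ⟩
    x * sumUpTo (suc D) (λ i → p (suc i) * x ^ i)             ≡⟨ *-distribˡ-sumUpTo (suc D) x (λ i → p (suc i) * x ^ i) ⟩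
    sumUpTo (suc D) (λ i → x * (p (suc i) * x ^ i))           ≡⟨ sumUpTo-cong (suc D) _ _ (λ i _ → reorder x (p (suc i)) (x ^ i)) ⟩
    sumUpTo (suc D) (λ i → p (suc i) * x ^ suc i)             ∎)
    where
    open ≡-Reasoning
    reorder : ∀ x a b → x * (a * b) ≡ a * (x * b)
    reorder = solve-∀
    *-distribˡ-sumUpTo : ∀ K c (f : Poly) → c * sumUpTo K f ≡ sumUpTo K (λ i → c * f i)
    *-distribˡ-sumUpTo zero    c f = *-zeroʳ c
    *-distribˡ-sumUpTo (suc K) c f = trans (*-distribˡ-+ c (f 0) (sumUpTo K (tailₚ f)))
      (cong (_+_ (c * f 0)) (*-distribˡ-sumUpTo K c (tailₚ f)))

  eval≡evalₚ : ∀ d c x → eval d c x ≡ evalₚ d (coeff d c) x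
  eval≡evalₚ d c x = begin
    eval d c x                                           ≡⟨ sumFin≡sum (suc d) (λ i → c i * x ^ toℕ i) ⟩
    sum (λ i → c i * x ^ toℕ i)                          ≡⟨ sum-cong-≗ {suc d} (λ i → cong (_* x ^ toℕ i) (sym (coeff-toℕ d c i))) ⟩
    sum {suc d} (λ i → coeff d c (toℕ i) * x ^ toℕ i)    ≡⟨ sum-toℕ (suc d) (λ i → coeff d c i * x ^ i) ⟩
    sumUpTo (suc d) (λ i → coeff d c i * x ^ i)          ≡⟨ evalₚ-as-sumUpTo d (coeff d c) x ⟨
    evalₚ d (coeff d c) x                                ∎
    where open ≡-Reasoning

  root∣constant : ∀ {k} D (p : Poly) x → k ∣ x → k ∣ evalₚ D p x → k ∣ p 0
  root∣constant zero    p x k∣x k∣p[x] = k∣p[x]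
  root∣constant (suc D) p x k∣x k∣p[x] = ∣-resp-≡ (cancel (p 0) (x * evalₚ D (tailₚ p) x))
    (∣m∣n⇒∣m-n k∣p[x] (∣m⇒∣m*n (evalₚ D (tailₚ p) x) k∣x))
    where
    cancel : ∀ a b → (a + b) - b ≡ a
    cancel = solve-∀

  -- The polynomials x^m ± 1

  coeff-fromℕ< : ∀ d c i (i<d : i ℕ.< suc d) → coeff d c i ≡ c (fromℕ< i<d)
  coeff-fromℕ< d c i i<d with i ℕ.<? suc d
  ... | yes _   = refl
  ... | no  i≮d = ⊥-elim (i≮d i<d)

  xPowPlus-top : ∀ m s (j : Fin (suc m)) → toℕ j ≡ m → toℕ j ≢ 0 → xPowPlus m s j ≡ + 1
  xPowPlus-top m s j j≡m j≢0 with toℕ j ℕ.≟ m | toℕ j ℕ.≟ 0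
  ... | yes _   | no _    = refl
  ... | no  j≢m | _       = ⊥-elim (j≢m j≡m)
  ... | _       | yes j≡0 = ⊥-elim (j≢0 j≡0)

  xPowPlus-bottom : ∀ m s (j : Fin (suc m)) → toℕ j ≢ m → toℕ j ≡ 0 → xPowPlus m s j ≡ s
  xPowPlus-bottom m s j j≢m j≡0 with toℕ j ℕ.≟ m | toℕ j ℕ.≟ 0
  ... | no _    | yes _   = +-identityˡ s
  ... | yes j≡m | _       = ⊥-elim (j≢m j≡m)
  ... | _       | no j≢0  = ⊥-elim (j≢0 j≡0)

  xPowPlus-middle : ∀ m s (j : Fin (suc m)) → toℕ j ≢ m → toℕ j ≢ 0 → xPowPlus m s j ≡ + 0
  xPowPlus-middle m s j j≢m j≢0 with toℕ j ℕ.≟ m | toℕ j ℕ.≟ 0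
  ... | no _    | no _    = refl
  ... | yes j≡m | _       = ⊥-elim (j≢m j≡m)
  ... | _       | yes j≡0 = ⊥-elim (j≢0 j≡0)

  evalₚ-monomial : ∀ D p x → (∀ i → i ℕ.< D → p i ≡ + 0) → p D ≡ + 1 → evalₚ D p x ≡ x ^ D
  evalₚ-monomial zero    p x _    p₀≡1 = p₀≡1
  evalₚ-monomial (suc D) p x p≡0 p[D]≡1 =
    trans (cong₂ (λ a b → a + x * b) (p≡0 0 (s≤s z≤n)) (evalₚ-monomial D (tailₚ p) x (λ i i<D → p≡0 (suc i) (s≤s i<D)) p[D]≡1))
          (+-identityˡ (x * x ^ D))

  module _ (m′ : ℕ) (s : ℤ) where

    private
      m : ℕ
      m = suc m′

    xPowPlusₚ : Poly
    xPowPlusₚ = coeff m (xPowPlus m s)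

    xPowPlusₚ-lead : xPowPlusₚ m ≡ + 1
    xPowPlusₚ-lead = trans (coeff-fromℕ< m (xPowPlus m s) m (ℕ.n<1+n m))
      (xPowPlus-top m s _ (Fin.toℕ-fromℕ< (ℕ.n<1+n m)) (λ eq → ℕ.1+n≢0 (trans (sym (Fin.toℕ-fromℕ< (ℕ.n<1+n m))) eq)))

    xPowPlusₚ-eval : ∀ x → evalₚ m xPowPlusₚ x ≡ x ^ m + s
    xPowPlusₚ-eval x = trans (cong₂ (λ a b → a + x * b) constant (evalₚ-monomial m′ (tailₚ xPowPlusₚ) x middle xPowPlusₚ-lead))
      (+-comm s (x * x ^ m′))
      where
      constant : xPowPlusₚ 0 ≡ s
      constant = trans (coeff-fromℕ< m (xPowPlus m s) 0 (s≤s z≤n)) (xPowPlus-bottom m s _ (λ ()) refl)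
      middle : ∀ i → i ℕ.< m′ → xPowPlusₚ (suc i) ≡ + 0
      middle i i<m′ = trans (coeff-fromℕ< m (xPowPlus m s) (suc i) i<1+m)
        (xPowPlus-middle m s _
          (λ eq → ℕ.<-irrefl (trans (sym (Fin.toℕ-fromℕ< i<1+m)) eq) (s≤s i<m′))
          (λ eq → ℕ.1+n≢0 (trans (sym (Fin.toℕ-fromℕ< i<1+m)) eq)))
        where
        i<1+m : suc i ℕ.< suc m
        i<1+m = ℕ.m<n⇒m<1+n (s≤s i<m′)

  -- Fermat's little theorem and Euler's criterion

  suc[k]*[1+n]C[1+k] : ∀ n k → suc k ℕ.* (suc n ℕ.C suc k) ≡ suc n ℕ.* (n ℕ.C k)
  suc[k]*[1+n]C[1+k] zero    zero    = refl
  suc[k]*[1+n]C[1+k] zero    (suc k) = ℕ.*-zeroʳ (suc (suc k))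
  suc[k]*[1+n]C[1+k] (suc n) zero    = trans (ℕ.*-identityˡ _) (trans (ℕ.nC1≡n (suc (suc n))) (sym (ℕ.*-identityʳ _)))
  suc[k]*[1+n]C[1+k] (suc n) (suc k) = begin
    suc (suc k) ℕ.* (suc (suc n) ℕ.C suc (suc k))
      ≡⟨ cong (suc (suc k) ℕ.*_) (ℕ.nCk+nC[k+1]≡[n+1]C[k+1] (suc n) (suc k)) ⟨
    suc (suc k) ℕ.* (A ℕ.+ B)
      ≡⟨ split (suc k) A B ⟩
    suc k ℕ.* A ℕ.+ A ℕ.+ suc (suc k) ℕ.* B
      ≡⟨ cong₂ (λ u v → u ℕ.+ A ℕ.+ v) (suc[k]*[1+n]C[1+k] n k) (suc[k]*[1+n]C[1+k] n (suc k)) ⟩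
    suc n ℕ.* (n ℕ.C k) ℕ.+ A ℕ.+ suc n ℕ.* (n ℕ.C suc k)
      ≡⟨ collect (suc n) (n ℕ.C k) (n ℕ.C suc k) A ⟩
    suc n ℕ.* ((n ℕ.C k) ℕ.+ (n ℕ.C suc k)) ℕ.+ A
      ≡⟨ cong (λ z → suc n ℕ.* z ℕ.+ A) (ℕ.nCk+nC[k+1]≡[n+1]C[k+1] n k) ⟩
    suc n ℕ.* A ℕ.+ A
      ≡⟨ ℕ.+-comm (suc n ℕ.* A) A ⟩
    suc (suc n) ℕ.* (suc n ℕ.C suc k)
      ∎
    where
    open ≡-Reasoning
    A B : ℕ
    A = suc n ℕ.C suc k
    B = suc n ℕ.C suc (suc k)
    split : ∀ k a b → suc k ℕ.* (a ℕ.+ b) ≡ k ℕ.* a ℕ.+ a ℕ.+ suc k ℕ.* b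
    split = ℕ-solve-∀
    collect : ∀ n x y a → n ℕ.* x ℕ.+ a ℕ.+ n ℕ.* y ≡ n ℕ.* (x ℕ.+ y) ℕ.+ a
    collect = ℕ-solve-∀

  prime∣C : ∀ {p} → Prime (suc p) → ∀ k → suc k ℕ.< suc p → suc p ℕ.∣ (suc p ℕ.C suc k)
  prime∣C {p} q-prime k k<p with euclidsLemma (suc k) (suc p ℕ.C suc k) q-prime
    (ℕ.divides (p ℕ.C k) (trans (suc[k]*[1+n]C[1+k] p k) (ℕ.*-comm (suc p) (p ℕ.C k))))
  ... | inj₁ q∣k   = ⊥-elim (ℕ.<⇒≱ k<p (ℕ.∣⇒≤ q∣k))
  ... | inj₂ q∣qCk = q∣qCk

  ^ᴿ≡^ : ∀ x n → x ^ᴿ n ≡ x ^ n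
  ^ᴿ≡^ x zero    = refl
  ^ᴿ≡^ x (suc n) = cong (x *_) (^ᴿ≡^ x n)

  ×ᴿ≡* : ∀ n x → n ×ᴿ x ≡ + n * x
  ×ᴿ≡* zero    x = refl
  ×ᴿ≡* (suc n) x = trans (cong (_+_ x) (×ᴿ≡* n x)) (sym (suc-* (+ n) x))

  binomial : ∀ n x → (x + + 1) ^ n ≡ sum {suc n} (λ k → + (n ℕ.C toℕ k) * x ^ toℕ k)
  binomial n x = begin
    (x + + 1) ^ n                         ≡⟨ ^ᴿ≡^ (x + + 1) n ⟨
    (x + + 1) ^ᴿ n                        ≡⟨ Binomial.theorem n x (+ 1) ⟩
    Binomial.binomialExpansion x (+ 1) n  ≡⟨ sum-cong-≗ {suc n} term≡ ⟩
    sum {suc n} (λ k → + (n ℕ.C toℕ k) * x ^ toℕ k) ∎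
    where
    open ≡-Reasoning
    term≡ : ∀ k → Binomial.binomialTerm x (+ 1) n k ≡ + (n ℕ.C toℕ k) * x ^ toℕ k
    term≡ k = begin
      (n ℕ.C toℕ k) ×ᴿ (x ^ᴿ toℕ k * (+ 1) ^ᴿ (n ∸ toℕ k))  ≡⟨ ×ᴿ≡* (n ℕ.C toℕ k) _ ⟩
      + (n ℕ.C toℕ k) * (x ^ᴿ toℕ k * (+ 1) ^ᴿ (n ∸ toℕ k)) ≡⟨ cong (λ z → + (n ℕ.C toℕ k) * (x ^ᴿ toℕ k * z))
                                                               (trans (^ᴿ≡^ (+ 1) (n ∸ toℕ k)) (^-zeroˡ (n ∸ toℕ k))) ⟩
      + (n ℕ.C toℕ k) * (x ^ᴿ toℕ k * + 1)                 ≡⟨ cong (+ (n ℕ.C toℕ k) *_) (trans (*-identityʳ _) (^ᴿ≡^ x (toℕ k))) ⟩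
      + (n ℕ.C toℕ k) * x ^ toℕ k                           ∎

  sum-∣ : ∀ {d k} (f : Fin k → ℤ) → (∀ i → d ∣ f i) → d ∣ sum f
  sum-∣ {k = zero}  f d∣f = ∣0
  sum-∣ {k = suc k} f d∣f = ∣m∣n⇒∣m+n (d∣f zero) (sum-∣ (f ∘ suc) (d∣f ∘ suc))

  -- In (x + 1)^q only the outer binomial coefficients survive modulo q.
  binomial-mod-prime : ∀ {q} → Prime q → ∀ x → + q ∣ (x + + 1) ^ q - (x ^ q + + 1)
  binomial-mod-prime {zero}  ()      x
  binomial-mod-prime {suc p} q-prime x = ∣-resp-≡ (sym difference≡middle) (sum-∣ middle middle-divisible)
    where
    t : Fin (suc (suc p)) → ℤ
    t k = + (suc p ℕ.C toℕ k) * x ^ toℕ k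
    middle : Fin p → ℤ
    middle j = t (suc (inject₁ j))
    top : t (fromℕ (suc p)) ≡ x ^ suc p
    top = trans (cong (λ i → + (suc p ℕ.C i) * x ^ i) (Fin.toℕ-fromℕ (suc p)))
      (trans (cong (λ c → + c * x ^ suc p) (ℕ.nCn≡1 (suc p))) (*-identityˡ (x ^ suc p)))
    expansion : (x + + 1) ^ suc p ≡ (+ 1 + sum middle) + x ^ suc p
    expansion = trans (binomial (suc p) x) (trans (sum-init-last t) (cong (_+_ (+ 1 + sum middle)) top))
    cancel : ∀ M X → ((+ 1 + M) + X) - (X + + 1) ≡ M
    cancel = solve-∀
    difference≡middle : (x + + 1) ^ suc p - (x ^ suc p + + 1) ≡ sum middle
    difference≡middle = trans (cong (λ z → z - (x ^ suc p + + 1)) expansion) (cancel (sum middle) (x ^ suc p))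
    middle-divisible : ∀ j → + suc p ∣ middle j
    middle-divisible j = ∣m⇒∣m*n (x ^ toℕ (suc (inject₁ j))) (∣ᵤ⇒∣ {+ suc p} {+ (suc p ℕ.C toℕ (suc (inject₁ j)))}
      (subst (λ i → suc p ℕ.∣ (suc p ℕ.C suc i)) (sym (Fin.toℕ-inject₁ j))
        (prime∣C q-prime (toℕ j) (s≤s (Fin.toℕ<n j)))))

  fermat-pow : ∀ {q} → Prime q → ∀ a → + q ∣ (+ a) ^ q - + a
  fermat-pow {zero}  ()      a
  fermat-pow {suc p} q-prime zero    = ∣-resp-≡ (sym (trans (+-identityʳ _) (*-zeroˡ ((+ 0) ^ p)))) ∣0
  fermat-pow {suc p} q-prime (suc a) = ∣-resp-≡ (trans (telescope ((+ a + + 1) ^ suc p) ((+ a) ^ suc p) (+ a))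
                                                       (cong (λ z → z ^ suc p - z) a+1≡1+a))
    (∣m∣n⇒∣m+n (binomial-mod-prime q-prime (+ a)) (fermat-pow q-prime a))
    where
    telescope : ∀ A X a → (A - (X + + 1)) + (X - a) ≡ A - (a + + 1)
    telescope = solve-∀
    a+1≡1+a : + a + + 1 ≡ + suc a
    a+1≡1+a = trans (sym (pos-+ a 1)) (cong +_ (ℕ.+-comm a 1))

  fermat : ∀ {p} → Prime (suc p) → ∀ y → ¬ suc p ℕ.∣ y → + suc p ∣ (+ y) ^ p - + 1
  fermat {p} q-prime y q∤y with prime-∣-* q-prime (+ y) ((+ y) ^ p - + 1)
    (∣-resp-≡ (factor (+ y) ((+ y) ^ p)) (fermat-pow q-prime y))
    where
    factor : ∀ y Y → y * Y - y ≡ y * (Y - + 1)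
    factor = solve-∀
  ... | inj₁ q∣y    = ⊥-elim (q∤y (∣⇒∣ᵤ q∣y))
  ... | inj₂ q∣yᵖ-1 = q∣yᵖ-1

  ¬∣-small : ∀ {q v} → 0 ℕ.< v → v ℕ.< q → ¬ + q ∣ + v
  ¬∣-small {v = suc v} _ v<q q∣v = ℕ.<⇒≱ v<q (ℕ.∣⇒≤ (∣⇒∣ᵤ q∣v))

  ¬∣-residues : ∀ {q a b} → a ℕ.< b → b ℕ.< q → ¬ + q ∣ + a - + b
  ¬∣-residues {q} {a} {b} a<b b<q q∣a-b = ¬∣-small (ℕ.m<n⇒0<n∸m a<b) (ℕ.≤-<-trans (ℕ.m∸n≤m b a) b<q)
    (∣-resp-≡ (trans ([+m]-[+n]≡m⊖n b a) (⊖-≥ (ℕ.<⇒≤ a<b))) (∣-swap-sub (+ a) (+ b) q∣a-b))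

  pow-∣-sub : ∀ {k} u v → k ∣ u - v → ∀ e → k ∣ u ^ e - v ^ e
  pow-∣-sub u v k∣u-v zero    = ∣0
  pow-∣-sub u v k∣u-v (suc e) = ∣-resp-≡ (telescope u v (u ^ e) (v ^ e))
    (∣m∣n⇒∣m+n (∣n⇒∣m*n u (pow-∣-sub u v k∣u-v e)) (∣n⇒∣m*n (v ^ e) k∣u-v))
    where
    telescope : ∀ u v U V → u * (U - V) + V * (u - v) ≡ u * U - v * V
    telescope = solve-∀

  square-pow : ∀ y m → (y * y) ^ m ≡ y ^ (m ℕ.+ m)
  square-pow y m = begin
    (y * y) ^ m       ≡⟨ cong (λ z → (y * z) ^ m) (*-identityʳ y) ⟨
    (y ^ 2) ^ m       ≡⟨ ^-*-assoc y 2 m ⟩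
    y ^ (2 ℕ.* m)     ≡⟨ cong (y ^_) (cong (m ℕ.+_) (ℕ.+-identityʳ m)) ⟩
    y ^ (m ℕ.+ m)     ∎
    where open ≡-Reasoning

  module _ {m′ : ℕ} (q-prime : Prime (suc (suc m′ ℕ.+ suc m′))) where

    private
      m q : ℕ
      m = suc m′
      q = suc (m ℕ.+ m)

    square-root : ∀ y → ¬ q ℕ.∣ y → + q ∣ (+ y * + y) ^ m - + 1
    square-root y q∤y = ∣-resp-≡ (cong (_- + 1) (sym (square-pow (+ y) m))) (fermat q-prime y q∤y)

    residue-root : ∀ x y → ¬ q ℕ.∣ x → + q ∣ + y * + y - + x → + q ∣ (+ x) ^ m - + 1
    residue-root x y q∤x q∣y²-x = ∣-resp-≡ (telescope ((+ x) ^ m) ((+ y * + y) ^ m))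
      (∣m∣n⇒∣m+n (pow-∣-sub (+ x) (+ y * + y) (∣-swap-sub (+ y * + y) (+ x) q∣y²-x) m) (square-root y q∤y))
      where
      telescope : ∀ A B → (A - B) + (B - + 1) ≡ A - + 1
      telescope = solve-∀
      cancel : ∀ Y x → Y - (Y - x) ≡ x
      cancel = solve-∀
      q∤y : ¬ q ℕ.∣ y
      q∤y q∣y = q∤x (∣⇒∣ᵤ (∣-resp-≡ (cancel (+ y * + y) (+ x)) (∣m∣n⇒∣m-n (∣n⇒∣m*n (+ y) (∣ᵤ⇒∣ q∣y)) q∣y²-x)))

    xᵐ-1-roots≤m : ∀ {rs} → All (λ r → + q ∣ r ^ m - + 1) rs → DistinctMod q rs → length rs ℕ.≤ m
    xᵐ-1-roots≤m roots distinct = roots≤degree q q-prime (coeff-deg m (xPowPlus m (- + 1)))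
      (All.map (λ {r} → ∣-resp-≡ (sym (xPowPlusₚ-eval m′ (- + 1) r))) roots) distinct nonzeroMod
      where
      nonzeroMod : NonzeroMod q m (xPowPlusₚ m′ (- + 1))
      nonzeroMod xᵐ-1≡0 = ¬∣-small (s≤s z≤n) (s≤s (s≤s z≤n))
        (∣-resp-≡ (xPowPlusₚ-lead m′ (- + 1)) (xᵐ-1≡0 m ℕ.≤-refl))

    squares : List ℤ
    squares = map (λ y → + y * + y) (applyUpTo suc m)

    m<q : m ℕ.< q
    m<q = s≤s (ℕ.m≤m+n m m)

    squares-roots : All (λ r → + q ∣ r ^ m - + 1) squares
    squares-roots = All.map⁺ (All.applyUpTo⁺₁ suc m (λ {i} i<m →
      square-root (suc i) (λ q∣i → ¬∣-small (s≤s z≤n) (ℕ.≤-<-trans i<m m<q) (∣ᵤ⇒∣ q∣i))))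

    squares-distinct : DistinctMod q squares
    squares-distinct = AllPairs.map⁺ (AllPairs.applyUpTo⁺₁ suc m (λ {i} {j} i<j j<m → distinct (s≤s i<j) j<m))
      where
      difference-of-squares : ∀ a b → a * a - b * b ≡ (a - b) * (a + b)
      difference-of-squares = solve-∀
      distinct : ∀ {a b} → a ℕ.< b → b ℕ.≤ m → ¬ + q ∣ + a * + a - + b * + b
      distinct {a} {b} a<b b≤m q∣a²-b²
        with prime-∣-* q-prime (+ a - + b) (+ a + + b) (∣-resp-≡ (difference-of-squares (+ a) (+ b)) q∣a²-b²)
      ... | inj₁ q∣a-b = ¬∣-residues a<b (ℕ.≤-<-trans b≤m m<q) q∣a-b
      ... | inj₂ q∣a+b = ¬∣-small (ℕ.<-≤-trans (ℕ.≤-<-trans z≤n a<b) (ℕ.m≤n+m b a))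
                            (s≤s (ℕ.+-mono-≤ (ℕ.<⇒≤ (ℕ.<-≤-trans a<b b≤m)) b≤m)) (∣-resp-≡ (sym (pos-+ a b)) q∣a+b)

    -- The m squares already exhaust the roots of x^m − 1.
    nonresidue-not-root : ∀ x → ¬ Any (λ y → q ℕ.∣ ℤ.∣ + y * + y - + x ∣) (upTo q) → ¬ + q ∣ (+ x) ^ m - + 1
    nonresidue-not-root x nonresidue q∣xᵐ-1 =
      ℕ.<-irrefl refl (subst (ℕ._≤ m) length≡ (xᵐ-1-roots≤m {+ x ∷ squares} (q∣xᵐ-1 ∷ squares-roots) (x≢squares ∷ squares-distinct)))
      where
      x≢squares : All (λ b → ¬ + q ∣ + x - b) squares
      x≢squares = All.map⁺ (All.applyUpTo⁺₁ suc m (λ {i} i<m q∣x-i² →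
        nonresidue (lose (∈-upTo⁺ (ℕ.≤-<-trans i<m m<q)) (∣⇒∣ᵤ (∣-swap-sub (+ x) (+ suc i * + suc i) q∣x-i²)))))
      length≡ : length (+ x ∷ squares) ≡ suc m
      length≡ = cong suc (trans (length-map (λ y → + y * + y) (applyUpTo suc m)) (length-applyUpTo suc m))

    fermat-squared : ∀ x → ¬ q ℕ.∣ x → + q ∣ ((+ x) ^ m - + 1) * ((+ x) ^ m + + 1)
    fermat-squared x q∤x = ∣-resp-≡ (trans (cong (_- + 1) (^-distribˡ-+-* (+ x) m m)) (difference-of-squares ((+ x) ^ m)))
      (fermat q-prime x q∤x)
      where
      difference-of-squares : ∀ X → X * X - + 1 ≡ (X - + 1) * (X + + 1)
      difference-of-squares = solve-∀

    nonresidue-root : ∀ x → ¬ q ℕ.∣ x → ¬ Any (λ y → q ℕ.∣ ℤ.∣ + y * + y - + x ∣) (upTo q) →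
      + q ∣ (+ x) ^ m + + 1
    nonresidue-root x q∤x nonresidue = [ ⊥-elim ∘ nonresidue-not-root x nonresidue , id ]′
      (prime-∣-* q-prime ((+ x) ^ m - + 1) ((+ x) ^ m + + 1) (fermat-squared x q∤x))

  -- Counting the roots of f

  length-filter-split : ∀ {A : Set} {P Q : A → Set} (P? : ∀ x → Dec (P x)) (Q? : ∀ x → Dec (Q x)) xs →
    length (filter P? xs) ≡ length (filter (λ x → P? x ×-dec Q? x) xs) ℕ.+ length (filter (λ x → P? x ×-dec ¬? (Q? x)) xs)
  length-filter-split P? Q? []       = refl
  length-filter-split P? Q? (x ∷ xs) with P? x | Q? x
  ... | yes _ | yes _ = cong suc (length-filter-split P? Q? xs)
  ... | yes _ | no  _ = trans (cong suc (length-filter-split P? Q? xs)) (sym (ℕ.+-suc _ _))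
  ... | no  _ | _     = length-filter-split P? Q? xs

  ∣+q^k∣ : ∀ q k → ℤ.∣ (+ q) ^ k ∣ ≡ q ℕ.^ k
  ∣+q^k∣ q zero    = refl
  ∣+q^k∣ q (suc k) = trans (abs-* (+ q) ((+ q) ^ k)) (cong (q ℕ.*_) (∣+q^k∣ q k))

  module _ {m′ : ℕ} (q-prime : Prime (suc (suc m′ ℕ.+ suc m′))) (n : ℕ) (a : Fin (suc n) → ℤ)
           (q∤a₀ : ¬ suc (suc m′ ℕ.+ suc m′) ℕ.∣ ℤ.∣ a zero ∣) where

    private
      m q : ℕ
      m = suc m′
      q = suc (m ℕ.+ m)

    f : Poly
    f = coeff n a

    f-nonzeroMod : NonzeroMod q n f
    f-nonzeroMod f≡0 = q∤a₀ (∣⇒∣ᵤ (∣-resp-≡ (coeff-toℕ n a zero) (f≡0 0 z≤n)))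

    resultant-commonRoots : ∀ s rs → All (λ r → + q ∣ evalₚ n f r) rs → All (λ r → + q ∣ r ^ m + s) rs →
      DistinctMod q rs → q ℕ.^ length rs ℕ.∣ ℤ.∣ resultant n m a (xPowPlus m s) ∣
    resultant-commonRoots s rs f-roots g-roots distinct =
      subst (ℕ._∣ ℤ.∣ resultant n m a (xPowPlus m s) ∣) (∣+q^k∣ q (length rs))
        (∣⇒∣ᵤ (resultant-divisible q a (xPowPlus m s) fFactors gFactors (xPowPlusₚ-lead m′ s)))
      where
      g-nonzeroMod : NonzeroMod q m (xPowPlusₚ m′ s)
      g-nonzeroMod g≡0 = ¬∣-small (s≤s z≤n) (s≤s (s≤s z≤n)) (∣-resp-≡ (xPowPlusₚ-lead m′ s) (g≡0 m ℕ.≤-refl))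
      fFactors : LinearFactorsMod q rs n f
      fFactors = linearFactorsMod q q-prime rs n f (coeff-deg n a) f-roots distinct f-nonzeroMod
      gFactors : LinearFactorsMod q rs m (xPowPlusₚ m′ s)
      gFactors = linearFactorsMod q q-prime rs m (xPowPlusₚ m′ s) (coeff-deg m (xPowPlus m s))
        (All.map (λ {r} → ∣-resp-≡ (sym (xPowPlusₚ-eval m′ s r))) g-roots) distinct g-nonzeroMod

    IsRoot IsResidue : ℕ → Set
    IsRoot x    = q ℕ.∣ ℤ.∣ eval n a (+ x) ∣
    IsResidue x = ¬ q ℕ.∣ x × Any (λ y → q ℕ.∣ ℤ.∣ + y * + y - + x ∣) (upTo q)

    IsRoot? : ∀ x → Dec (IsRoot x)
    IsRoot? x = divides? q (eval n a (+ x))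

    residueRoots nonresidueRoots : List ℕ
    residueRoots    = filter (λ x → IsRoot? x ×-dec IsQR? q x) (upTo q)
    nonresidueRoots = filter (λ x → IsRoot? x ×-dec ¬? (IsQR? q x)) (upTo q)

    residues-distinct : ∀ {xs} → AllPairs (λ x y → x ℕ.< y × y ℕ.< q) xs → DistinctMod q (map +_ xs)
    residues-distinct ordered = AllPairs.map⁺ (AllPairs.map (λ (x<y , y<q) → ¬∣-residues x<y y<q) ordered)

    upTo-ordered : AllPairs (λ x y → x ℕ.< y × y ℕ.< q) (upTo q)
    upTo-ordered = AllPairs.applyUpTo⁺₁ (λ x → x) q (λ x<y y<q → x<y , y<q)

    root⇒evalₚ : ∀ x → IsRoot x → + q ∣ evalₚ n f (+ x)
    root⇒evalₚ x q∣f[x] = ∣-resp-≡ (eval≡evalₚ n a (+ x)) (∣ᵤ⇒∣ q∣f[x])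

    root⇒coprime : ∀ x → IsRoot x → ¬ q ℕ.∣ x
    root⇒coprime x q∣f[x] q∣x =
      q∤a₀ (∣⇒∣ᵤ (∣-resp-≡ (coeff-toℕ n a zero) (root∣constant n f (+ x) (∣ᵤ⇒∣ q∣x) (root⇒evalₚ x q∣f[x]))))

    resultant-residueRoots : q ℕ.^ length residueRoots ℕ.∣ ℤ.∣ resultant n m a (xPowPlus m (- + 1)) ∣
    resultant-residueRoots = subst (λ k → q ℕ.^ k ℕ.∣ ℤ.∣ resultant n m a (xPowPlus m (- + 1)) ∣)
      (length-map +_ residueRoots)
      (resultant-commonRoots (- + 1) (map +_ residueRoots)
        (All.map⁺ (All.map (λ {x} (q∣f[x] , _) → root⇒evalₚ x q∣f[x]) residueRoots-all))
        (All.map⁺ (All.map (λ {x} (_ , q∤x , square) →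
            residue-root q-prime x (proj₁ (satisfied square)) q∤x (∣ᵤ⇒∣ (proj₂ (satisfied square))))
          residueRoots-all))
        (residues-distinct (AllPairs.filter⁺ (λ x → IsRoot? x ×-dec IsQR? q x) upTo-ordered)))
      where
      residueRoots-all : All (λ x → IsRoot x × IsResidue x) residueRoots
      residueRoots-all = All.all-filter (λ x → IsRoot? x ×-dec IsQR? q x) (upTo q)

    resultant-nonresidueRoots : q ℕ.^ length nonresidueRoots ℕ.∣ ℤ.∣ resultant n m a (xPowPlus m (+ 1)) ∣
    resultant-nonresidueRoots = subst (λ k → q ℕ.^ k ℕ.∣ ℤ.∣ resultant n m a (xPowPlus m (+ 1)) ∣)
      (length-map +_ nonresidueRoots)
      (resultant-commonRoots (+ 1) (map +_ nonresidueRoots)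
        (All.map⁺ (All.map (λ {x} (q∣f[x] , _) → root⇒evalₚ x q∣f[x]) nonresidueRoots-all))
        (All.map⁺ (All.map (λ {x} (q∣f[x] , ¬residue) →
            nonresidue-root q-prime x (root⇒coprime x q∣f[x]) (λ square → ¬residue (root⇒coprime x q∣f[x] , square)))
          nonresidueRoots-all))
        (residues-distinct (AllPairs.filter⁺ (λ x → IsRoot? x ×-dec ¬? (IsQR? q x)) upTo-ordered)))
      where
      nonresidueRoots-all : All (λ x → IsRoot x × ¬ IsResidue x) nonresidueRoots
      nonresidueRoots-all = All.all-filter (λ x → IsRoot? x ×-dec ¬? (IsQR? q x)) (upTo q)

    numRoots∸numQRRoots : numRoots q n a ∸ numQRRoots q n a ≡ length nonresidueRoots
    numRoots∸numQRRoots = trans (cong (_∸ length residueRoots) (length-filter-split IsRoot? (IsQR? q) (upTo q)))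
      (ℕ.m+n∸m≡n (length residueRoots) (length nonresidueRoots))

open import Defs
open import Data.Nat using (ℕ; suc; _∸_; _^_)
open import Data.Nat.DivMod using (_/_)
open import Data.Nat.Divisibility using (_∣_)
open import Data.Nat.Primality using (Prime)
open import Data.Integer using (ℤ; +_; -_; ∣_∣)
open import Data.Fin using (Fin; fromℕ; zero)
open import Data.Product using (_×_)
open import Relation.Nullary using (¬_)
open import Relation.Binary.PropositionalEquality using (_≡_; _≢_)

open import Data.Nat using (zero; _+_)
import Data.Nat.Properties as ℕ
open import Data.Nat.DivMod using (m*n/n≡m)
open import Data.Nat.Divisibility using (divides)
open import Data.Nat.Primality using (¬prime[1])
open import Data.Empty using (⊥-elim)
open import Data.Product using (∃; _,_)
open import Relation.Binary.PropositionalEquality using (refl; sym; trans; cong; subst)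
open Lemmas using (resultant-residueRoots; resultant-nonresidueRoots; numRoots∸numQRRoots)

odd⇒≡1+2t : ∀ q → ¬ (2 ∣ q) → ∃ λ t → q ≡ suc (t + t)
odd⇒≡1+2t zero          2∤q = ⊥-elim (2∤q (divides 0 refl))
odd⇒≡1+2t (suc zero)    2∤q = 0 , refl
odd⇒≡1+2t (suc (suc q)) 2∤q with odd⇒≡1+2t q (λ { (divides k q≡2k) → 2∤q (divides (suc k) (cong (λ x → suc (suc x)) q≡2k)) })
... | t , q≡1+2t = suc t , cong (λ x → suc (suc x)) (trans q≡1+2t (sym (ℕ.+-suc t t)))

[t+t]/2≡t : ∀ t → (t + t) / 2 ≡ t
[t+t]/2≡t t = trans (cong (_/ 2) (trans (cong (_+_ t) (sym (ℕ.+-identityʳ t))) (ℕ.*-comm 2 t))) (m*n/n≡m t 2)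

theorem3 : (q : ℕ) → Prime q → ¬ (2 ∣ q) →
    (n : ℕ) (a : Fin (suc n) → ℤ) → a (fromℕ n) ≢ + 0 →
    ¬ (q ∣ ∣ a zero ∣) →
    (ℓ b : ℕ) → ℓ ≡ numRoots q n a → b ≡ numQRRoots q n a →
    (q ^ b ∣ ∣ resultant n ((q ∸ 1) / 2) a (xPowPlus ((q ∸ 1) / 2) (- (+ 1))) ∣)
    × (q ^ (ℓ ∸ b) ∣ ∣ resultant n ((q ∸ 1) / 2) a (xPowPlus ((q ∸ 1) / 2) (+ 1)) ∣)
theorem3 q q-prime q-odd n a _ q∤a₀ ℓ b refl refl with odd⇒≡1+2t q q-odd
... | zero  , refl = ⊥-elim (¬prime[1] q-prime)
... | suc t , refl rewrite [t+t]/2≡t (suc t) =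
  resultant-residueRoots q-prime n a q∤a₀ ,
  subst (λ k → q ^ k ∣ ∣ resultant n (suc t) a (xPowPlus (suc t) (+ 1)) ∣)
        (sym (numRoots∸numQRRoots q-prime n a q∤a₀))
        (resultant-nonresidueRoots q-prime n a q∤a₀)
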